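{- Let $\mathcal{A}_{\mathbf S}$ be a deformation of the braid arrangement in $\mathbb{R}^n$ and let $T\in\mathcal{T}^{(m)}(n)$ with $r_{\mathbf S}(T)\neq0$. Then every maximal $\mathbf S$-cadet sequence of $T$ with more than one node intersects some other maximal $\mathbf S$-cadet sequence of $T$.
   Context: A deformation of the braid arrangement in $\mathbb{R}^n$ is a finite set $\mathcal{A}$ of hyperplanes $x_i-x_j=s$ ($1\le i<j\le n$, $s\in\mathbb{Z}$), encoded by $\mathbf S=(S_{i,j})_{i<j}$, $S_{i,j}=\{s:(x_i-x_j=s)\in\mathcal{A}\}$. For $i<j$: $S^-_{i,j}:=\{s\ge0:-s\in S_{i,j}\}$, $S^-_{j,i}:=\{0\}\cup\{s>0:s\in S_{i,j}\}$. $m=\max\{|s|:s\in\bigcup S_{i,j}\}$. $\mathcal{T}^{(m)}(n)$: rooted plane trees whose vertices are nodes (exactly $m+1$ ordered children) or leaves, with $n$ nodes labeled bijectively by $1,\dots,n$. $\mathsf{cadet}(u)$: rightmost child of node $u$ that is a node, if any. $\mathsf{lsib}(v)$: number of children of the parent of $v$ to the left of $v$. A cadet sequence is a sequence of nodes $(v_1,\dots,v_k)$ with $v_p=\mathsf{cadet}(v_{p-1})$; it is an $\mathbf S$-cadet sequence if $\sum_{p=i+1}^{j}\mathsf{lsib}(v_p)\notin S^-_{v_i,v_j}$ for all $i<j$. A cadet sequence $(v_1,\dots,v_k)$ is maximal if $v_k$ has no cadet and $v_1$ is not the cadet of any node. An $\mathbf S$-cadet sequence $(v_i,\dots,v_j)$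 inside the maximal cadet sequence $(v_1,\dots,v_k)$ is a maximal $\mathbf S$-cadet sequence if (a) $i=1$ or $(v_{i-1},\dots,v_j)$ is not $\mathbf S$-cadet, and (b) $j=k$ or $(v_i,\dots,v_{j+1})$ is not $\mathbf S$-cadet. An $\mathbf S$-boxing of $T$ is a partition $B$ of all nodes of $T$ into $\mathbf S$-cadet sequences, and $r_{\mathbf S}(T)=\sum_B(-1)^{n-|B|}$ over all $\mathbf S$-boxings $B$ of $T$, $|B|$ the number of parts. -}

module Defs where

open import Data.Bool using (Bool; true; false; _∧_; _∨_; not; if_then_else_)
open import Data.Nat using (ℕ; zero; suc; _∸_; _⊔_; _<ᵇ_; _≡ᵇ_; pred)
open import Data.Nat.Properties using () renaming (_<?_ to _<ℕ?_)
open import Data.Fin using (Fin; toℕ)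
open import Data.Fin.Properties using (_≟_)
open import Data.Integer using (ℤ; +_; -_; ∣_∣; -1ℤ; 0ℤ; _^_) renaming (_+_ to _+ℤ_)
import Data.Integer.Properties as ℤP
open import Data.List using (List; []; _∷_; _++_; map; concatMap; foldr; length;
  take; drop; lookup; allFin; head; last; filterᵇ)
open import Data.Bool.ListAction using (all; any)
open import Data.Nat.ListAction using (sum)
open import Data.Maybe using (Maybe; just; nothing; maybe; fromMaybe)
open import Data.Vec using (Vec; []; _∷_; toList)
open import Data.Product using (Σ; _×_; _,_)
open import Data.Sum using (_⊎_)
open import Relation.Nullary using (does; yes; no; ¬_)
open import Relation.Binary.PropositionalEquality using (_≡_)

-- S i j is the finite set S_{i,j} (as a list of integers); only the
-- entries with i < j are meaningful (all other entries are ignored by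
-- every definition below).  Nodes/coordinates 1..n are Fin n (0-based).

Deformation : ℕ → Set
Deformation n = Fin n → Fin n → List ℤ

mOf : ∀ {n} → Deformation n → ℕ
mOf {n} S = foldr _⊔_ 0
  (concatMap (λ i → concatMap (λ j →
      if toℕ i <ᵇ toℕ j then map ∣_∣ (S i j) else []) (allFin n)) (allFin n))

_∈ℤᵇ_ : ℤ → List ℤ → Bool
z ∈ℤᵇ xs = any (λ y → does (y ℤP.≟ z)) xs

SMinusᵇ : ∀ {n} → Deformation n → Fin n → Fin n → ℕ → Bool
SMinusᵇ S a b s with toℕ a <ℕ? toℕ b | toℕ b <ℕ? toℕ a
... | yes _ | _     = (- (+ s)) ∈ℤᵇ S a b
... | no _  | yes _ = (s ≡ᵇ 0) ∨ ((0 <ᵇ s) ∧ ((+ s) ∈ℤᵇ S b a))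
... | no _  | no _  = false

-- Rooted plane trees: every node has exactly k ordered children
-- (k = m+1 for 𝒯^(m)(n)), nodes carry labels in Fin n.

data Tree (k n : ℕ) : Set where
  leaf : Tree k n
  node : Fin n → Vec (Tree k n) k → Tree k n

orElse : ∀ {A : Set} → Maybe A → Maybe A → Maybe A
orElse (just x) _ = just x
orElse nothing  y = y

module _ {k n : ℕ} where

  mutual
    labels : Tree k n → List (Fin n)
    labels leaf        = []
    labels (node u cs) = u ∷ labelsV cs

    labelsV : ∀ {j} → Vec (Tree k n) j → List (Fin n)
    labelsV []       = []
    labelsV (t ∷ ts) = labels t ++ labelsV ts

  mutual
    childrenOf : Fin n → Tree k n → Maybe (List (Tree k n))
    childrenOf u leaf        = nothing
    childrenOf u (node w cs) =
      if does (u ≟ w) then just (toList cs) else childrenOfV u cs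

    childrenOfV : ∀ {j} → Fin n → Vec (Tree k n) j → Maybe (List (Tree k n))
    childrenOfV u []       = nothing
    childrenOfV u (t ∷ ts) = orElse (childrenOf u t) (childrenOfV u ts)

  lastNode : List (Tree k n) → Maybe (Fin n)
  lastNode []               = nothing
  lastNode (leaf ∷ ts)      = lastNode ts
  lastNode (node v _ ∷ ts)  = orElse (lastNode ts) (just v)

  cadet : Tree k n → Fin n → Maybe (Fin n)
  cadet T u = maybe lastNode nothing (childrenOf u T)

  posAmong : Fin n → ℕ → List (Tree k n) → Maybe ℕ
  posAmong v i []              = nothing
  posAmong v i (leaf ∷ ts)     = posAmong v (suc i) ts
  posAmong v i (node w _ ∷ ts) =
    if does (v ≟ w) then just i else posAmong v (suc i) ts

  mutual
    posOf : Fin n → Tree k n → Maybe ℕ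
    posOf v leaf        = nothing
    posOf v (node w cs) = orElse (posAmong v 0 (toList cs)) (posOfV v cs)

    posOfV : ∀ {j} → Fin n → Vec (Tree k n) j → Maybe ℕ
    posOfV v []       = nothing
    posOfV v (t ∷ ts) = orElse (posOf v t) (posOfV v ts)

  -- lsib(v): number of children of the parent of v to the left of v
  -- (only used for non-root nodes; value 0 for the root is irrelevant)
  lsib : Tree k n → Fin n → ℕ
  lsib T v = fromMaybe 0 (posOf v T)

  isCadetOfᵇ : Tree k n → Fin n → Fin n → Bool
  isCadetOfᵇ T u v = maybe (λ w → does (w ≟ v)) false (cadet T u)

  linkedᵇ : Tree k n → Fin n → List (Fin n) → Bool
  linkedᵇ T u []       = true
  linkedᵇ T u (v ∷ vs) = isCadetOfᵇ T u v ∧ linkedᵇ T v vs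

  CadetSeqᵇ : Tree k n → List (Fin n) → Bool
  CadetSeqᵇ T []       = false
  CadetSeqᵇ T (v ∷ vs) = linkedᵇ T v vs

  -- Σ_{p=i+1}^{j} lsib(v_p)   (0-based indices)
  lsibSum : Tree k n → (vs : List (Fin n)) → Fin (length vs) → Fin (length vs) → ℕ
  lsibSum T vs i j = sum (map (lsib T) (take (toℕ j ∸ toℕ i) (drop (suc (toℕ i)) vs)))

  SCadetᵇ : Deformation n → Tree k n → List (Fin n) → Bool
  SCadetᵇ S T vs = CadetSeqᵇ T vs ∧
    all (λ i → all (λ j → not (toℕ i <ᵇ toℕ j) ∨
                          not (SMinusᵇ S (lookup vs i) (lookup vs j) (lsibSum T vs i j)))
             (allFin (length vs)))
        (allFin (length vs))

  MaxCadetSeq : Tree k n → List (Fin n) → Set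
  MaxCadetSeq T M =
    CadetSeqᵇ T M ≡ true ×
    (∀ v → last M ≡ just v → cadet T v ≡ nothing) ×
    (∀ u v → head M ≡ just v → ¬ (cadet T u ≡ just v))

  -- the segment (v_i,…,v_j) of M (0-based indices)
  segment : List (Fin n) → ℕ → ℕ → List (Fin n)
  segment M i j = take (suc j ∸ i) (drop i M)

  MaxSCadetSeq : Deformation n → Tree k n → List (Fin n) → Set
  MaxSCadetSeq S T C =
    Σ (List (Fin n)) λ M → MaxCadetSeq T M ×
    Σ ℕ λ i → Σ ℕ λ j →
      (i Data.Nat.≤ j) × (j Data.Nat.< length M) ×
      (C ≡ segment M i j) ×
      (SCadetᵇ S T C ≡ true) ×
      (i ≡ 0 ⊎ SCadetᵇ S T (segment M (pred i) j) ≡ false) ×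
      (suc j ≡ length M ⊎ SCadetᵇ S T (segment M i (suc j)) ≡ false)

module _ {A : Set} where

  insertEach : A → List (List A) → List (List (List A))
  insertEach x []      = []
  insertEach x (b ∷ P) = ((x ∷ b) ∷ P) ∷ map (b ∷_) (insertEach x P)

  -- every set partition of (the elements of) a duplicate-free list,
  -- each exactly once, blocks given as lists
  setPartitions : List A → List (List (List A))
  setPartitions []       = [] ∷ []
  setPartitions (x ∷ xs) =
    concatMap (λ P → ((x ∷ []) ∷ P) ∷ insertEach x P) (setPartitions xs)

  insertAll : A → List A → List (List A)
  insertAll x []       = (x ∷ []) ∷ []
  insertAll x (y ∷ ys) = (x ∷ y ∷ ys) ∷ map (y ∷_) (insertAll x ys)

  permutations : List A → List (List A)
  permutations []       = [] ∷ []
  permutations (x ∷ xs) = concatMap (insertAll x) (permutations xs)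

module _ {k n : ℕ} where

  -- a block (set of nodes) is a part of an 𝐒-boxing iff it is the node
  -- set of an 𝐒-cadet sequence, i.e. some ordering of it is 𝐒-cadet
  SCadetBlockᵇ : Deformation n → Tree k n → List (Fin n) → Bool
  SCadetBlockᵇ S T b = any (SCadetᵇ S T) (permutations b)

  boxings : Deformation n → Tree k n → List (List (List (Fin n)))
  boxings S T = filterᵇ (all (SCadetBlockᵇ S T)) (setPartitions (allFin n))

  rS : Deformation n → Tree k n → ℤ
  rS S T = foldr (λ B acc → (-1ℤ ^ (n ∸ length B)) +ℤ acc) 0ℤ (boxings S T)

{-# OPTIONS --safe #-}
module Submission where

-- Suppose C = (a, b, …) is a maximal S-cadet sequence with at least two nodes that meets no
-- other maximal S-cadet sequence, and let M be the maximal cadet sequence containing it.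
-- A cadet sequence that shares a node with M is a segment of M, and an S-cadet segment
-- extends to a maximal one; so every S-cadet sequence meeting C lies inside C, and one
-- containing a starts with a, b.  Hence in an S-boxing the part containing a is either {a}
-- or a part containing b, and moving a between these two places is a sign-reversing
-- involution on S-boxings: r_S(T) = 0.  Since the competing maximal S-cadet sequences are
-- segments of M, their existence is decidable, which turns this contrapositive into a witness.

open import Defs

module SetPartitionSums where

  open import Data.Bool using (Bool; true; false; if_then_else_)
  open import Data.Bool.ListAction using (all; any)
  open import Data.Bool.Properties using (T-≡; ⇔→≡)
  open import Data.Empty using (⊥-elim)
  open import Data.Integer using (ℤ; 0ℤ; 1ℤ; -1ℤ; _+_; _*_; _^_)
  import Data.Integer.Properties as ℤ
  open import Data.Integer.Tactic.RingSolver using (solve-∀)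
  open import Data.List using (List; []; _∷_; [_]; _++_; map; concatMap; foldr; length; filterᵇ)
  open import Data.List.Membership.Propositional using (_∈_; _∉_; find; lose)
  open import Data.List.Membership.Propositional.Properties
    using (∈-map⁺; ∈-map⁻; ∈-concatMap⁺; ∈-concatMap⁻; ∈-∃++)
  open import Data.List.Relation.Binary.Permutation.Propositional as ↭
    using (_↭_; ↭-refl; ↭-prep; ↭-swap; ↭-sym; ↭-trans; ↭-reflexive)
  open import Data.List.Relation.Binary.Permutation.Propositional.Properties
    using (∈-resp-↭; ↭-empty-inv; drop-mid; shift)
  open import Data.List.Relation.Binary.Subset.Propositional using (_⊆_)
  open import Data.List.Relation.Unary.All as All using (All; []; _∷_)
  open import Data.List.Relation.Unary.Any as Any using (here; there)
  open import Data.List.Relation.Unary.Any.Properties using (any⁺; any⁻)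
  open import Data.Nat using (ℕ; zero; suc; _≤_; _∸_; z≤n; s≤s)
  import Data.Nat.Properties as ℕ
  open import Data.Product using (∃; _×_; _,_)
  open import Data.Sum using (_⊎_; inj₁; inj₂)
  open import Function.Bundles using (Equivalence; mk⇔)
  open import Relation.Binary.Core using (_Preserves_⟶_)
  open import Relation.Binary.PropositionalEquality
    using (_≡_; _≢_; refl; sym; trans; cong; cong₂; module ≡-Reasoning)
  import Algebra.Properties.CommutativeSemigroup ℤ.+-commutativeSemigroup as +-CS
  import Algebra.Properties.CommutativeSemigroup ℤ.*-commutativeSemigroup as *-CS

  private
    variable
      X Y : Set

  infix 10 ∑[_] ∏[_]

  ∑[_] : (X → ℤ) → List X → ℤ
  ∑[ f ] []       = 0ℤ
  ∑[ f ] (x ∷ xs) = f x + ∑[ f ] xs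

  ∏[_] : (X → ℤ) → List X → ℤ
  ∏[ f ] []       = 1ℤ
  ∏[ f ] (x ∷ xs) = f x * ∏[ f ] xs

  ∑-++ : ∀ {f : X → ℤ} xs ys → ∑[ f ] (xs ++ ys) ≡ ∑[ f ] xs + ∑[ f ] ys
  ∑-++ []       ys = sym (ℤ.+-identityˡ _)
  ∑-++ {f = f} (x ∷ xs) ys = trans (cong (f x +_) (∑-++ xs ys)) (sym (ℤ.+-assoc (f x) _ _))

  ∑-map : ∀ {f : Y → ℤ} (g : X → Y) xs → ∑[ f ] (map g xs) ≡ ∑[ (λ x → f (g x)) ] xs
  ∑-map g []       = refl
  ∑-map {f = f} g (x ∷ xs) = cong (f (g x) +_) (∑-map g xs)

  ∑-concatMap : ∀ {f : Y → ℤ} (g : X → List Y) xs →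
                ∑[ f ] (concatMap g xs) ≡ ∑[ (λ x → ∑[ f ] (g x)) ] xs
  ∑-concatMap g []       = refl
  ∑-concatMap {f = f} g (x ∷ xs) =
    trans (∑-++ (g x) (concatMap g xs)) (cong (∑[ f ] (g x) +_) (∑-concatMap g xs))

  ∑-cong : ∀ {f g : X → ℤ} xs → (∀ {x} → x ∈ xs → f x ≡ g x) → ∑[ f ] xs ≡ ∑[ g ] xs
  ∑-cong []       f≡g = refl
  ∑-cong (x ∷ xs) f≡g = cong₂ _+_ (f≡g (here refl)) (∑-cong xs (λ y∈ → f≡g (there y∈)))

  ∑-zero : ∀ {f : X → ℤ} xs → (∀ {x} → x ∈ xs → f x ≡ 0ℤ) → ∑[ f ] xs ≡ 0ℤ
  ∑-zero []       f≡0 = refl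
  ∑-zero (x ∷ xs) f≡0 = cong₂ _+_ (f≡0 (here refl)) (∑-zero xs (λ y∈ → f≡0 (there y∈)))

  ∑-+ : ∀ (f g : X → ℤ) xs → ∑[ (λ x → f x + g x) ] xs ≡ ∑[ f ] xs + ∑[ g ] xs
  ∑-+ f g []       = refl
  ∑-+ f g (x ∷ xs) =
    trans (cong (f x + g x +_) (∑-+ f g xs)) (+-CS.interchange (f x) (g x) (∑[ f ] xs) (∑[ g ] xs))

  ∑-*ˡ : ∀ c (f : X → ℤ) xs → ∑[ (λ x → c * f x) ] xs ≡ c * ∑[ f ] xs
  ∑-*ˡ c f []       = sym (ℤ.*-zeroʳ c)
  ∑-*ˡ c f (x ∷ xs) = trans (cong (c * f x +_) (∑-*ˡ c f xs)) (sym (ℤ.*-distribˡ-+ c (f x) _))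

  ∑-filterᵇ : ∀ (p : X → Bool) (f : X → ℤ) xs →
              foldr (λ x acc → f x + acc) 0ℤ (filterᵇ p xs) ≡ ∑[ (λ x → if p x then f x else 0ℤ) ] xs
  ∑-filterᵇ p f []       = refl
  ∑-filterᵇ p f (x ∷ xs) with p x
  ... | true  = cong (f x +_) (∑-filterᵇ p f xs)
  ... | false = trans (∑-filterᵇ p f xs) (sym (ℤ.+-identityˡ _))

  ∏-sign : ∀ (p : X → Bool) xs →
           ∏[ (λ x → if p x then -1ℤ else 0ℤ) ] xs ≡ (if all p xs then -1ℤ ^ length xs else 0ℤ)
  ∏-sign p []       = refl
  ∏-sign p (x ∷ xs) with p x
  ... | false = ℤ.*-zeroˡ (∏[ (λ x → if p x then -1ℤ else 0ℤ) ] xs)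
  ... | true rewrite ∏-sign p xs with all p xs
  ...   | true  = refl
  ...   | false = ℤ.*-zeroʳ -1ℤ

  -1^[m∸n] : ∀ m n → n ≤ m → -1ℤ ^ (m ∸ n) ≡ -1ℤ ^ m * -1ℤ ^ n
  -1^[m∸n] m       zero    _         = sym (ℤ.*-identityʳ _)
  -1^[m∸n] (suc m) (suc n) (s≤s n≤m) = trans (-1^[m∸n] m n n≤m) (signs (-1ℤ ^ m) (-1ℤ ^ n))
    where
    signs : ∀ a b → a * b ≡ -1ℤ * a * (-1ℤ * b)
    signs = solve-∀

  module _ {A : Set} where

    -- Block lists representing the same set partition.
    infix 4 _≋_

    data _≋_ : List (List A) → List (List A) → Set where
      ≋-[]    : [] ≋ []
      ≋-∷     : ∀ {β β′ P P′} → β ↭ β′ → P ≋ P′ → β ∷ P ≋ β′ ∷ P′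
      ≋-swap  : ∀ β γ P → β ∷ γ ∷ P ≋ γ ∷ β ∷ P
      ≋-trans : ∀ {P Q R} → P ≋ Q → Q ≋ R → P ≋ R

    ≋-refl : ∀ {P} → P ≋ P
    ≋-refl {[]}    = ≋-[]
    ≋-refl {β ∷ P} = ≋-∷ ↭-refl ≋-refl

    Invariant : (List (List A) → ℤ) → Set
    Invariant F = F Preserves _≋_ ⟶ _≡_

    Invariant-∷ : ∀ {F} β → Invariant F → Invariant (λ P → F (β ∷ P))
    Invariant-∷ β F-inv P≋P′ = F-inv (≋-∷ ↭-refl P≋P′)

    ∑-insertEach-∷ : ∀ (F : List (List A) → ℤ) x β P →
      ∑[ F ] (insertEach x (β ∷ P)) ≡ F ((x ∷ β) ∷ P) + ∑[ (λ Z → F (β ∷ Z)) ] (insertEach x P)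
    ∑-insertEach-∷ F x β P = cong (F ((x ∷ β) ∷ P) +_) (∑-map (β ∷_) (insertEach x P))

    ∑-insertEach-∷∷ : ∀ (F : List (List A) → ℤ) x β γ P →
      ∑[ F ] (insertEach x (β ∷ γ ∷ P)) ≡
      F ((x ∷ β) ∷ γ ∷ P) + (F (β ∷ (x ∷ γ) ∷ P) + ∑[ (λ Z → F (β ∷ γ ∷ Z)) ] (insertEach x P))
    ∑-insertEach-∷∷ F x β γ P =
      trans (∑-insertEach-∷ F x β (γ ∷ P))
              (cong (F ((x ∷ β) ∷ γ ∷ P) +_) (∑-insertEach-∷ (λ Z → F (β ∷ Z)) x γ P))

    ∑-insertEach-resp-≋ : ∀ x {F} → Invariant F → ∀ {P P′} → P ≋ P′ →
                          ∑[ F ] (insertEach x P) ≡ ∑[ F ] (insertEach x P′)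
    ∑-insertEach-resp-≋ x F-inv ≋-[] = refl
    ∑-insertEach-resp-≋ x {F} F-inv (≋-∷ {β} {β′} {P} {P′} β↭β′ P≋P′) = begin
      ∑[ F ] (insertEach x (β ∷ P))                         ≡⟨ ∑-insertEach-∷ F x β P ⟩
      F ((x ∷ β) ∷ P) + ∑[ (λ Z → F (β ∷ Z)) ] (insertEach x P)
        ≡⟨ cong₂ _+_ (F-inv (≋-∷ (↭-prep x β↭β′) P≋P′))
                     (∑-insertEach-resp-≋ x (Invariant-∷ β F-inv) P≋P′) ⟩
      F ((x ∷ β′) ∷ P′) + ∑[ (λ Z → F (β ∷ Z)) ] (insertEach x P′)
        ≡⟨ cong (F ((x ∷ β′) ∷ P′) +_)
                (∑-cong (insertEach x P′) (λ {Z} _ → F-inv {β ∷ Z} {β′ ∷ Z} (≋-∷ β↭β′ ≋-refl))) ⟩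
      F ((x ∷ β′) ∷ P′) + ∑[ (λ Z → F (β′ ∷ Z)) ] (insertEach x P′)
        ≡⟨ sym (∑-insertEach-∷ F x β′ P′) ⟩
      ∑[ F ] (insertEach x (β′ ∷ P′))                       ∎
      where open ≡-Reasoning
    ∑-insertEach-resp-≋ x {F} F-inv (≋-swap β γ P) = begin
      ∑[ F ] (insertEach x (β ∷ γ ∷ P))                         ≡⟨ ∑-insertEach-∷∷ F x β γ P ⟩
      F ((x ∷ β) ∷ γ ∷ P) + (F (β ∷ (x ∷ γ) ∷ P) + Sβγ)
        ≡⟨ cong₂ (λ u v → u + (v + Sβγ)) (F-inv (≋-swap _ _ _)) (F-inv (≋-swap _ _ _)) ⟩
      F (γ ∷ (x ∷ β) ∷ P) + (F ((x ∷ γ) ∷ β ∷ P) + Sβγ)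
        ≡⟨ +-CS.x∙yz≈y∙xz (F (γ ∷ (x ∷ β) ∷ P)) (F ((x ∷ γ) ∷ β ∷ P)) Sβγ ⟩
      F ((x ∷ γ) ∷ β ∷ P) + (F (γ ∷ (x ∷ β) ∷ P) + Sβγ)
        ≡⟨ cong (λ u → F ((x ∷ γ) ∷ β ∷ P) + (F (γ ∷ (x ∷ β) ∷ P) + u))
                (∑-cong (insertEach x P) (λ {Z} _ → F-inv (≋-swap β γ Z))) ⟩
      F ((x ∷ γ) ∷ β ∷ P) + (F (γ ∷ (x ∷ β) ∷ P) + Sγβ)       ≡⟨ sym (∑-insertEach-∷∷ F x γ β P) ⟩
      ∑[ F ] (insertEach x (γ ∷ β ∷ P))                         ∎
      where
      open ≡-Reasoning
      Sβγ Sγβ : ℤ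
      Sβγ = ∑[ (λ Z → F (β ∷ γ ∷ Z)) ] (insertEach x P)
      Sγβ = ∑[ (λ Z → F (γ ∷ β ∷ Z)) ] (insertEach x P)
    ∑-insertEach-resp-≋ x F-inv (≋-trans P≋Q Q≋R) =
      trans (∑-insertEach-resp-≋ x F-inv P≋Q) (∑-insertEach-resp-≋ x F-inv Q≋R)

    adjoin : A → (List (List A) → ℤ) → List (List A) → ℤ
    adjoin x F P = F ([ x ] ∷ P) + ∑[ F ] (insertEach x P)

    ∑-setPartitions-∷ : ∀ x xs F → ∑[ F ] (setPartitions (x ∷ xs)) ≡ ∑[ adjoin x F ] (setPartitions xs)
    ∑-setPartitions-∷ x xs F = ∑-concatMap (λ P → ([ x ] ∷ P) ∷ insertEach x P) (setPartitions xs)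

    adjoin-invariant : ∀ x {F} → Invariant F → Invariant (adjoin x F)
    adjoin-invariant x F-inv P≋P′ =
      cong₂ _+_ (F-inv (≋-∷ ↭-refl P≋P′)) (∑-insertEach-resp-≋ x F-inv P≋P′)

    insertTwice : (List (List A) → ℤ) → A → A → List (List A) → ℤ
    insertTwice F x y Q = ∑[ (λ R → ∑[ F ] (insertEach x R)) ] (insertEach y Q)

    insertTwice-∷ : ∀ F x y β Q → insertTwice F x y (β ∷ Q) ≡
      F ((x ∷ y ∷ β) ∷ Q) + ∑[ (λ Z → F ((y ∷ β) ∷ Z)) ] (insertEach x Q) +
      (∑[ (λ Z → F ((x ∷ β) ∷ Z)) ] (insertEach y Q) + insertTwice (λ Z → F (β ∷ Z)) x y Q)
    insertTwice-∷ F x y β Q = cong₂ _+_ (∑-insertEach-∷ F x (y ∷ β) Q) (begin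
      ∑[ (λ R → ∑[ F ] (insertEach x R)) ] (map (β ∷_) (insertEach y Q))
        ≡⟨ ∑-map (β ∷_) (insertEach y Q) ⟩
      ∑[ (λ R → ∑[ F ] (insertEach x (β ∷ R))) ] (insertEach y Q)
        ≡⟨ ∑-cong (insertEach y Q) (λ {R} _ → ∑-insertEach-∷ F x β R) ⟩
      ∑[ (λ R → F ((x ∷ β) ∷ R) + ∑[ (λ Z → F (β ∷ Z)) ] (insertEach x R)) ] (insertEach y Q)
        ≡⟨ ∑-+ (λ R → F ((x ∷ β) ∷ R)) (λ R → ∑[ (λ Z → F (β ∷ Z)) ] (insertEach x R)) (insertEach y Q) ⟩
      ∑[ (λ Z → F ((x ∷ β) ∷ Z)) ] (insertEach y Q) + insertTwice (λ Z → F (β ∷ Z)) x y Q ∎)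
      where open ≡-Reasoning

    insertTwice-comm : ∀ {F} → Invariant F → ∀ x y Q → insertTwice F x y Q ≡ insertTwice F y x Q
    insertTwice-comm F-inv x y []      = refl
    insertTwice-comm {F} F-inv x y (β ∷ Q) = begin
      insertTwice F x y (β ∷ Q)                                       ≡⟨ insertTwice-∷ F x y β Q ⟩
      F ((x ∷ y ∷ β) ∷ Q) + Sy + (Sx + insertTwice (λ Z → F (β ∷ Z)) x y Q)
        ≡⟨ cong₂ (λ u v → u + Sy + (Sx + v))
                 (F-inv (≋-∷ (↭-swap x y ↭-refl) ≋-refl))
                 (insertTwice-comm (Invariant-∷ β F-inv) x y Q) ⟩
      F ((y ∷ x ∷ β) ∷ Q) + Sy + (Sx + insertTwice (λ Z → F (β ∷ Z)) y x Q)
        ≡⟨ +-CS.interchange (F ((y ∷ x ∷ β) ∷ Q)) Sy Sx (insertTwice (λ Z → F (β ∷ Z)) y x Q) ⟩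
      F ((y ∷ x ∷ β) ∷ Q) + Sx + (Sy + insertTwice (λ Z → F (β ∷ Z)) y x Q)
        ≡⟨ sym (insertTwice-∷ F y x β Q) ⟩
      insertTwice F y x (β ∷ Q)                                       ∎
      where
      open ≡-Reasoning
      Sx Sy : ℤ
      Sx = ∑[ (λ Z → F ((x ∷ β) ∷ Z)) ] (insertEach y Q)
      Sy = ∑[ (λ Z → F ((y ∷ β) ∷ Z)) ] (insertEach x Q)

    adjoin-adjoin : ∀ F x y Q → adjoin y (adjoin x F) Q ≡
      F ([ x ] ∷ [ y ] ∷ Q) + (F ((x ∷ [ y ]) ∷ Q) + ∑[ (λ Z → F ([ y ] ∷ Z)) ] (insertEach x Q)) +
      (∑[ (λ Z → F ([ x ] ∷ Z)) ] (insertEach y Q) + insertTwice F x y Q)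
    adjoin-adjoin F x y Q =
      cong₂ _+_ (cong (F ([ x ] ∷ [ y ] ∷ Q) +_) (∑-insertEach-∷ F x [ y ] Q))
                (∑-+ (λ Z → F ([ x ] ∷ Z)) (λ Z → ∑[ F ] (insertEach x Z)) (insertEach y Q))

    adjoin-comm : ∀ {F} → Invariant F → ∀ x y Q → adjoin y (adjoin x F) Q ≡ adjoin x (adjoin y F) Q
    adjoin-comm {F} F-inv x y Q = begin
      adjoin y (adjoin x F) Q                                           ≡⟨ adjoin-adjoin F x y Q ⟩
      F ([ x ] ∷ [ y ] ∷ Q) + (F ((x ∷ [ y ]) ∷ Q) + Sy) + (Sx + insertTwice F x y Q)
        ≡⟨ cong₂ (λ u v → u + (v + Sy) + (Sx + insertTwice F x y Q))
                 (F-inv (≋-swap [ x ] [ y ] Q)) (F-inv (≋-∷ (↭-swap x y ↭-refl) ≋-refl)) ⟩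
      F ([ y ] ∷ [ x ] ∷ Q) + (F ((y ∷ [ x ]) ∷ Q) + Sy) + (Sx + insertTwice F x y Q)
        ≡⟨ cong (λ u → F ([ y ] ∷ [ x ] ∷ Q) + (F ((y ∷ [ x ]) ∷ Q) + Sy) + (Sx + u))
                (insertTwice-comm F-inv x y Q) ⟩
      F ([ y ] ∷ [ x ] ∷ Q) + (F ((y ∷ [ x ]) ∷ Q) + Sy) + (Sx + insertTwice F y x Q)
        ≡⟨ exchange (F ([ y ] ∷ [ x ] ∷ Q)) (F ((y ∷ [ x ]) ∷ Q)) Sy Sx (insertTwice F y x Q) ⟩
      F ([ y ] ∷ [ x ] ∷ Q) + (F ((y ∷ [ x ]) ∷ Q) + Sx) + (Sy + insertTwice F y x Q)
        ≡⟨ sym (adjoin-adjoin F y x Q) ⟩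
      adjoin x (adjoin y F) Q                                           ∎
      where
      open ≡-Reasoning
      Sx Sy : ℤ
      Sx = ∑[ (λ Z → F ([ x ] ∷ Z)) ] (insertEach y Q)
      Sy = ∑[ (λ Z → F ([ y ] ∷ Z)) ] (insertEach x Q)
      exchange : ∀ a b c d e → a + (b + c) + (d + e) ≡ a + (b + d) + (c + e)
      exchange = solve-∀

    ∑-setPartitions-↭ : ∀ {xs ys} → xs ↭ ys → ∀ {F} → Invariant F →
                        ∑[ F ] (setPartitions xs) ≡ ∑[ F ] (setPartitions ys)
    ∑-setPartitions-↭ ↭.refl F-inv = refl
    ∑-setPartitions-↭ (↭.prep {xs} {ys} x xs↭ys) {F} F-inv = begin
      ∑[ F ] (setPartitions (x ∷ xs))          ≡⟨ ∑-setPartitions-∷ x xs F ⟩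
      ∑[ adjoin x F ] (setPartitions xs)       ≡⟨ ∑-setPartitions-↭ xs↭ys (adjoin-invariant x F-inv) ⟩
      ∑[ adjoin x F ] (setPartitions ys)       ≡⟨ sym (∑-setPartitions-∷ x ys F) ⟩
      ∑[ F ] (setPartitions (x ∷ ys))          ∎
      where open ≡-Reasoning
    ∑-setPartitions-↭ (↭.swap {xs} {ys} x y xs↭ys) {F} F-inv = begin
      ∑[ F ] (setPartitions (x ∷ y ∷ xs))           ≡⟨ ∑-setPartitions-∷ x (y ∷ xs) F ⟩
      ∑[ adjoin x F ] (setPartitions (y ∷ xs))      ≡⟨ ∑-setPartitions-∷ y xs (adjoin x F) ⟩
      ∑[ adjoin y (adjoin x F) ] (setPartitions xs)
        ≡⟨ ∑-setPartitions-↭ xs↭ys (adjoin-invariant y (adjoin-invariant x F-inv)) ⟩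
      ∑[ adjoin y (adjoin x F) ] (setPartitions ys)
        ≡⟨ ∑-cong (setPartitions ys) (λ {Q} _ → adjoin-comm F-inv x y Q) ⟩
      ∑[ adjoin x (adjoin y F) ] (setPartitions ys) ≡⟨ sym (∑-setPartitions-∷ x ys (adjoin y F)) ⟩
      ∑[ adjoin y F ] (setPartitions (x ∷ ys))      ≡⟨ sym (∑-setPartitions-∷ y (x ∷ ys) F) ⟩
      ∑[ F ] (setPartitions (y ∷ x ∷ ys))           ∎
      where open ≡-Reasoning
    ∑-setPartitions-↭ (↭.trans xs↭ys ys↭zs) F-inv =
      trans (∑-setPartitions-↭ xs↭ys F-inv) (∑-setPartitions-↭ ys↭zs F-inv)

    ∏-invariant : ∀ {h : List A → ℤ} → (∀ {β β′} → β ↭ β′ → h β ≡ h β′) → Invariant ∏[ h ]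
    ∏-invariant h-inv ≋-[]                   = refl
    ∏-invariant h-inv (≋-∷ β↭β′ P≋P′)        = cong₂ _*_ (h-inv β↭β′) (∏-invariant h-inv P≋P′)
    ∏-invariant {h} h-inv (≋-swap β γ P)     = *-CS.x∙yz≈y∙xz (h β) (h γ) (∏[ h ] P)
    ∏-invariant h-inv (≋-trans P≋Q Q≋R)      = trans (∏-invariant h-inv P≋Q) (∏-invariant h-inv Q≋R)

    ∈-setPartitions-∷⁻ : ∀ {x : A} {xs P} → P ∈ setPartitions (x ∷ xs) →
      ∃ λ Q → Q ∈ setPartitions xs × (P ≡ [ x ] ∷ Q ⊎ P ∈ insertEach x Q)
    ∈-setPartitions-∷⁻ {x} {xs} P∈
      with find (∈-concatMap⁻ (λ Q → ([ x ] ∷ Q) ∷ insertEach x Q) {xs = setPartitions xs} P∈)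
    ... | Q , Q∈ , here P≡   = Q , Q∈ , inj₁ P≡
    ... | Q , Q∈ , there P∈′ = Q , Q∈ , inj₂ P∈′

    length-insertEach : ∀ {x : A} {Q P} → P ∈ insertEach x Q → length P ≡ length Q
    length-insertEach {Q = β ∷ Q} (here refl) = refl
    length-insertEach {Q = β ∷ Q} (there P∈) with ∈-map⁻ (β ∷_) P∈
    ... | P₀ , P₀∈ , refl = cong suc (length-insertEach P₀∈)

    length-setPartitions : ∀ (xs : List A) {P} → P ∈ setPartitions xs → length P ≤ length xs
    length-setPartitions []       (here refl) = z≤n
    length-setPartitions (x ∷ xs) P∈ with ∈-setPartitions-∷⁻ {x} {xs} P∈
    ... | Q , Q∈ , inj₁ refl = s≤s (length-setPartitions xs Q∈)
    ... | Q , Q∈ , inj₂ P∈′ rewrite length-insertEach P∈′ = ℕ.m≤n⇒m≤1+n (length-setPartitions xs Q∈)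

    BlockOf : List A → List A → Set
    BlockOf xs β = β ≢ [] × β ⊆ xs

    BlockOf-∷ : ∀ {x : A} {xs β} → BlockOf xs β → BlockOf (x ∷ xs) β
    BlockOf-∷ (β≢[] , β⊆xs) = β≢[] , λ y∈β → there (β⊆xs y∈β)

    insertEach-blocks : ∀ {x : A} {xs Q P} → All (BlockOf xs) Q → P ∈ insertEach x Q →
                        All (BlockOf (x ∷ xs)) P
    insertEach-blocks {Q = β ∷ Q} ((_ , β⊆xs) ∷ Q-blocks) (here refl) =
      ((λ ()) , λ { (here refl) → here refl ; (there y∈β) → there (β⊆xs y∈β) }) ∷
      All.map BlockOf-∷ Q-blocks
    insertEach-blocks {Q = β ∷ Q} (β-block ∷ Q-blocks) (there P∈) with ∈-map⁻ (β ∷_) P∈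
    ... | P₀ , P₀∈ , refl = BlockOf-∷ β-block ∷ insertEach-blocks Q-blocks P₀∈

    setPartitions-blocks : ∀ (xs : List A) {P} → P ∈ setPartitions xs → All (BlockOf xs) P
    setPartitions-blocks []       (here refl) = []
    setPartitions-blocks (x ∷ xs) P∈ with ∈-setPartitions-∷⁻ {x} {xs} P∈
    ... | Q , Q∈ , inj₁ refl =
      ((λ ()) , λ { (here refl) → here refl }) ∷ All.map BlockOf-∷ (setPartitions-blocks xs Q∈)
    ... | Q , Q∈ , inj₂ P∈′ = insertEach-blocks (setPartitions-blocks xs Q∈) P∈′

    data InOneBlock (b : A) : List (List A) → Set where
      first : ∀ {β P} → b ∈ β → All (b ∉_) P → InOneBlock b (β ∷ P)
      later : ∀ {β P} → b ∉ β → InOneBlock b P → InOneBlock b (β ∷ P)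

    blocks-avoid : ∀ {b : A} {xs Q} → b ∉ xs → All (BlockOf xs) Q → All (b ∉_) Q
    blocks-avoid b∉xs = All.map (λ (_ , β⊆xs) b∈β → b∉xs (β⊆xs b∈β))

    insertEach-InOneBlock : ∀ {b : A} {Q P} → All (b ∉_) Q → P ∈ insertEach b Q → InOneBlock b P
    insertEach-InOneBlock {Q = β ∷ Q} (_ ∷ b∉Q) (here refl) = first (here refl) b∉Q
    insertEach-InOneBlock {Q = β ∷ Q} (b∉β ∷ b∉Q) (there P∈) with ∈-map⁻ (β ∷_) P∈
    ... | P₀ , P₀∈ , refl = later b∉β (insertEach-InOneBlock b∉Q P₀∈)

    setPartitions-InOneBlock : ∀ {b : A} {rest P} → b ∉ rest → P ∈ setPartitions (b ∷ rest) → InOneBlock b P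
    setPartitions-InOneBlock {b} {rest} b∉rest P∈ with ∈-setPartitions-∷⁻ {b} {rest} P∈
    ... | Q , Q∈ , inj₁ refl = first (here refl) (blocks-avoid b∉rest (setPartitions-blocks rest Q∈))
    ... | Q , Q∈ , inj₂ P∈′  =
      insertEach-InOneBlock (blocks-avoid b∉rest (setPartitions-blocks rest Q∈)) P∈′

    module _ (h : List A → ℤ) (a b : A) where

      private
        Toggles : List A → Set
        Toggles β = (b ∈ β → h (a ∷ β) ≡ h β) × (b ∉ β → h (a ∷ β) ≡ 0ℤ)

        ∑∏-insertEach-∷ : ∀ β P →
          ∑[ ∏[ h ] ] (insertEach a (β ∷ P)) ≡ h (a ∷ β) * ∏[ h ] P + h β * ∑[ ∏[ h ] ] (insertEach a P)
        ∑∏-insertEach-∷ β P = trans (∑-insertEach-∷ ∏[ h ] a β P)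
          (cong (h (a ∷ β) * ∏[ h ] P +_) (∑-*ˡ (h β) ∏[ h ] (insertEach a P)))

        ∑∏-insertEach-avoiding : ∀ {P} → All Toggles P → All (b ∉_) P → ∑[ ∏[ h ] ] (insertEach a P) ≡ 0ℤ
        ∑∏-insertEach-avoiding []                           []          = refl
        ∑∏-insertEach-avoiding {β ∷ P} ((_ , kill) ∷ togg) (b∉β ∷ b∉P) =
          trans (∑∏-insertEach-∷ β P)
            (trans (cong₂ (λ u v → u * ∏[ h ] P + h β * v) (kill b∉β) (∑∏-insertEach-avoiding togg b∉P))
                     (vanish (∏[ h ] P) (h β)))
          where
          vanish : ∀ p q → 0ℤ * p + q * 0ℤ ≡ 0ℤ
          vanish = solve-∀

        ∑∏-insertEach : ∀ {P} → All Toggles P → InOneBlock b P → ∑[ ∏[ h ] ] (insertEach a P) ≡ ∏[ h ] P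
        ∑∏-insertEach {β ∷ P} ((keep , _) ∷ togg) (first b∈β b∉P) =
          trans (∑∏-insertEach-∷ β P)
            (trans (cong₂ (λ u v → u * ∏[ h ] P + h β * v) (keep b∈β) (∑∏-insertEach-avoiding togg b∉P))
                     (right-vanish (h β) (∏[ h ] P)))
          where
          right-vanish : ∀ q p → q * p + q * 0ℤ ≡ q * p
          right-vanish = solve-∀
        ∑∏-insertEach {β ∷ P} ((_ , kill) ∷ togg) (later b∉β inP) =
          trans (∑∏-insertEach-∷ β P)
            (trans (cong₂ (λ u v → u * ∏[ h ] P + h β * v) (kill b∉β) (∑∏-insertEach togg inP))
                     (left-vanish (∏[ h ] P) (h β)))
          where
          left-vanish : ∀ p q → 0ℤ * p + q * p ≡ q * p
          left-vanish = solve-∀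

      -- Putting a as a singleton next to a partition P of b ∷ rest cancels against putting a
      -- into the block of b; every other placement of a has weight 0.
      ∑∏-setPartitions-toggle : ∀ rest → b ∉ rest → h [ a ] ≡ -1ℤ →
        (∀ {β} → BlockOf (b ∷ rest) β → b ∈ β → h (a ∷ β) ≡ h β) →
        (∀ {β} → BlockOf rest β → h (a ∷ β) ≡ 0ℤ) →
        ∑[ ∏[ h ] ] (setPartitions (a ∷ b ∷ rest)) ≡ 0ℤ
      ∑∏-setPartitions-toggle rest b∉rest h[a] keep kill =
        trans (∑-setPartitions-∷ a (b ∷ rest) ∏[ h ]) (∑-zero (setPartitions (b ∷ rest)) cancel)
        where
        toggles : ∀ {β} → BlockOf (b ∷ rest) β → Toggles β
        toggles (β≢[] , β⊆) = keep (β≢[] , β⊆) , λ b∉β → kill (β≢[] , λ x∈β → off-b b∉β x∈β (β⊆ x∈β))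
          where
          off-b : ∀ {β x} → b ∉ β → x ∈ β → x ∈ b ∷ rest → x ∈ rest
          off-b b∉β x∈β (here refl) = ⊥-elim (b∉β x∈β)
          off-b b∉β x∈β (there x∈)  = x∈

        opposite : ∀ p → -1ℤ * p + p ≡ 0ℤ
        opposite = solve-∀

        cancel : ∀ {P} → P ∈ setPartitions (b ∷ rest) → adjoin a ∏[ h ] P ≡ 0ℤ
        cancel {P} P∈ = trans
          (cong₂ (λ u v → u * ∏[ h ] P + v) h[a]
                 (∑∏-insertEach (All.map toggles (setPartitions-blocks (b ∷ rest) P∈))
                                (setPartitions-InOneBlock b∉rest P∈)))
          (opposite (∏[ h ] P))

    ∑-filter-all-good : ∀ (good : List A → Bool) n xs → length xs ≤ n →
      foldr (λ B acc → -1ℤ ^ (n ∸ length B) + acc) 0ℤ (filterᵇ (all good) (setPartitions xs)) ≡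
      -1ℤ ^ n * ∑[ ∏[ (λ β → if good β then -1ℤ else 0ℤ) ] ] (setPartitions xs)
    ∑-filter-all-good good n xs xs≤n = begin
      foldr (λ B acc → -1ℤ ^ (n ∸ length B) + acc) 0ℤ (filterᵇ (all good) (setPartitions xs))
        ≡⟨ ∑-filterᵇ (all good) (λ B → -1ℤ ^ (n ∸ length B)) (setPartitions xs) ⟩
      ∑[ (λ B → if all good B then -1ℤ ^ (n ∸ length B) else 0ℤ) ] (setPartitions xs)
        ≡⟨ ∑-cong (setPartitions xs) weight ⟩
      ∑[ (λ B → -1ℤ ^ n * ∏[ sign ] B) ] (setPartitions xs)
        ≡⟨ ∑-*ˡ (-1ℤ ^ n) ∏[ sign ] (setPartitions xs) ⟩
      -1ℤ ^ n * ∑[ ∏[ sign ] ] (setPartitions xs) ∎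
      where
      open ≡-Reasoning
      sign : List A → ℤ
      sign β = if good β then -1ℤ else 0ℤ
      weight : ∀ {B} → B ∈ setPartitions xs →
               (if all good B then -1ℤ ^ (n ∸ length B) else 0ℤ) ≡ -1ℤ ^ n * ∏[ sign ] B
      weight {B} B∈ rewrite ∏-sign good B with all good B
      ... | true  = -1^[m∸n] n (length B) (ℕ.≤-trans (length-setPartitions xs B∈) xs≤n)
      ... | false = sym (ℤ.*-zeroʳ (-1ℤ ^ n))

  module _ {A : Set} where

    private
      ∈-insertAll : ∀ (x : A) ys zs → ys ++ x ∷ zs ∈ insertAll x (ys ++ zs)
      ∈-insertAll x []       []       = here refl
      ∈-insertAll x []       (z ∷ zs) = here refl
      ∈-insertAll x (y ∷ ys) zs       = there (∈-map⁺ (y ∷_) (∈-insertAll x ys zs))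

      ∈-insertAll⁻ : ∀ (x : A) xs {ys} → ys ∈ insertAll x xs → ys ↭ x ∷ xs
      ∈-insertAll⁻ x []       (here refl) = ↭-refl
      ∈-insertAll⁻ x (y ∷ xs) (here refl) = ↭-refl
      ∈-insertAll⁻ x (y ∷ xs) (there ys∈) with ∈-map⁻ (y ∷_) ys∈
      ... | zs , zs∈ , refl = ↭-trans (↭-prep y (∈-insertAll⁻ x xs zs∈)) (↭-swap y x ↭-refl)

    ∈-permutations⁻ : ∀ (xs : List A) {ys} → ys ∈ permutations xs → ys ↭ xs
    ∈-permutations⁻ []       (here refl) = ↭-refl
    ∈-permutations⁻ (x ∷ xs) ys∈
      with zs , zs∈ , ys∈′ ← find (∈-concatMap⁻ (insertAll x) {xs = permutations xs} ys∈)
      = ↭-trans (∈-insertAll⁻ x zs ys∈′) (↭-prep x (∈-permutations⁻ xs zs∈))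

    ∈-permutations⁺ : ∀ (xs : List A) {ys} → ys ↭ xs → ys ∈ permutations xs
    ∈-permutations⁺ []       ys↭[] rewrite ↭-empty-inv ys↭[] = here refl
    ∈-permutations⁺ (x ∷ xs) ys↭x∷xs with ys₁ , ys₂ , refl ← ∈-∃++ (∈-resp-↭ (↭-sym ys↭x∷xs) (here refl)) =
      ∈-concatMap⁺ (insertAll x) {xs = permutations xs}
        (Any.map (λ { refl → ∈-insertAll x ys₁ ys₂ }) (∈-permutations⁺ xs (drop-mid ys₁ [] ys↭x∷xs)))

    any-permutations⁻ : ∀ (f : List A → Bool) xs → any f (permutations xs) ≡ true →
                        ∃ λ ys → ys ↭ xs × f ys ≡ true
    any-permutations⁻ f xs any≡true
      with ys , ys∈ , fys ← find (any⁻ f (permutations xs) (Equivalence.from T-≡ any≡true))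
      = ys , ∈-permutations⁻ xs ys∈ , Equivalence.to T-≡ fys

    any-permutations⁺ : ∀ (f : List A → Bool) xs {ys} → ys ↭ xs → f ys ≡ true →
                        any f (permutations xs) ≡ true
    any-permutations⁺ f xs ys↭xs fys =
      Equivalence.to T-≡ (any⁺ f (lose (∈-permutations⁺ xs ys↭xs) (Equivalence.from T-≡ fys)))

    any-permutations-resp-↭ : ∀ (f : List A → Bool) {xs xs′} → xs ↭ xs′ →
                              any f (permutations xs) ≡ any f (permutations xs′)
    any-permutations-resp-↭ f xs↭xs′ =
      ⇔→≡ {z = true} (mk⇔ (transport xs↭xs′) (transport (↭-sym xs↭xs′)))
      where
      transport : ∀ {us vs} → us ↭ vs → any f (permutations us) ≡ true → any f (permutations vs) ≡ true
      transport {us} {vs} us↭vs any≡true with ys , ys↭us , fys ← any-permutations⁻ f us any≡true =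
        any-permutations⁺ f vs (↭-trans ys↭us us↭vs) fys

    pick-two : ∀ {a b : A} {xs} → a ∈ xs → b ∈ xs → a ≢ b → ∃ λ rest → xs ↭ a ∷ b ∷ rest
    pick-two a∈xs b∈xs a≢b with ys , zs , refl ← ∈-∃++ a∈xs
      with ∈-resp-↭ (shift _ ys zs) b∈xs
    ... | here b≡a   = ⊥-elim (a≢b (sym b≡a))
    ... | there b∈ys++zs with us , vs , ys++zs≡ ← ∈-∃++ b∈ys++zs =
      us ++ vs , ↭-trans (shift _ ys zs) (↭-prep _ (↭-trans (↭-reflexive ys++zs≡) (shift _ us vs)))

module TreeParents where

  open import Data.Bool using (if_then_else_)
  open import Data.Empty using (⊥-elim)
  open import Data.Fin using (Fin)
  open import Data.Fin.Properties using (_≟_)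
  open import Data.List using (List; []; _∷_; _++_)
  open import Data.List.Membership.Propositional using (_∈_; _∉_)
  open import Data.List.Membership.Propositional.Properties using (∈-++⁺ˡ; ∈-++⁺ʳ)
  import Data.List.Relation.Unary.All as All
  import Data.List.Relation.Unary.All.Properties as All
  open import Data.List.Relation.Unary.AllPairs using ([]; _∷_)
  open import Data.List.Relation.Unary.Any using (here; there)
  open import Data.List.Relation.Unary.Unique.Propositional using (Unique)
  open import Data.Maybe using (Maybe; just; nothing)
  open import Data.Nat using (ℕ)
  open import Data.Product using (∃; _×_; _,_)
  open import Data.Vec using (Vec; []; _∷_; toList)
  open import Relation.Binary.PropositionalEquality using (_≡_; refl; sym; trans)
  open import Relation.Nullary using (does; yes; no)

  private
    Unique-++⁻ : ∀ {A : Set} (xs : List A) {ys} → Unique (xs ++ ys) →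
                 Unique xs × Unique ys × (∀ {z} → z ∈ xs → z ∉ ys)
    Unique-++⁻ []       u              = [] , u , λ ()
    Unique-++⁻ (x ∷ xs) (x∉xs++ys ∷ u) with Unique-++⁻ xs u
    ... | u-xs , u-ys , disjoint =
      All.++⁻ˡ xs x∉xs++ys ∷ u-xs , u-ys ,
      λ { (here refl) z∈ys → All.lookup (All.++⁻ʳ xs x∉xs++ys) z∈ys refl
        ; (there z∈xs) → disjoint z∈xs }

  module _ {k n : ℕ} where

    -- parentIn p v t is just q when v occurs in t with parent q, where p is the parent of the root of t
    mutual
      parentIn : Maybe (Fin n) → Fin n → Tree k n → Maybe (Maybe (Fin n))
      parentIn p v leaf        = nothing
      parentIn p v (node w cs) = if does (v ≟ w) then just p else parentInV (just w) v cs

      parentInV : ∀ {j} → Maybe (Fin n) → Fin n → Vec (Tree k n) j → Maybe (Maybe (Fin n))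
      parentInV p v []       = nothing
      parentInV p v (t ∷ ts) = orElse (parentIn p v t) (parentInV p v ts)

    mutual
      parentIn-∉ : ∀ p {v} (t : Tree k n) → v ∉ labels t → parentIn p v t ≡ nothing
      parentIn-∉ p leaf        v∉ = refl
      parentIn-∉ p {v} (node w cs) v∉ with v ≟ w
      ... | yes refl = ⊥-elim (v∉ (here refl))
      ... | no _     = parentInV-∉ (just w) cs (λ v∈ → v∉ (there v∈))

      parentInV-∉ : ∀ {j} p {v} (ts : Vec (Tree k n) j) → v ∉ labelsV ts → parentInV p v ts ≡ nothing
      parentInV-∉ p []       v∉ = refl
      parentInV-∉ p (t ∷ ts) v∉
        rewrite parentIn-∉ p t (λ v∈ → v∉ (∈-++⁺ˡ v∈)) = parentInV-∉ p ts (λ v∈ → v∉ (∈-++⁺ʳ (labels t) v∈))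

    root-∈-labelsV : ∀ {j v ws} (ts : Vec (Tree k n) j) → node v ws ∈ toList ts → v ∈ labelsV ts
    root-∈-labelsV (t ∷ ts) (here refl) = here refl
    root-∈-labelsV (t ∷ ts) (there v∈)  = ∈-++⁺ʳ (labels t) (root-∈-labelsV ts v∈)

    mutual
      child-∈-labels : ∀ {u v ws cs} (t : Tree k n) → childrenOf u t ≡ just cs → node v ws ∈ cs → v ∈ labels t
      child-∈-labels {u} (node w cs₀) ch≡ v∈ with u ≟ w | ch≡
      ... | yes refl | refl = there (root-∈-labelsV cs₀ v∈)
      ... | no _     | ch-cs₀≡ = there (child-∈-labelsV cs₀ ch-cs₀≡ v∈)

      child-∈-labelsV : ∀ {j u v ws cs} (ts : Vec (Tree k n) j) →
                        childrenOfV u ts ≡ just cs → node v ws ∈ cs → v ∈ labelsV ts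
      child-∈-labelsV {u = u} (t ∷ ts) ch≡ v∈ with childrenOf u t in ch-t≡ | ch≡
      ... | just _  | refl = ∈-++⁺ˡ (child-∈-labels t ch-t≡ v∈)
      ... | nothing | ch-ts≡ = ∈-++⁺ʳ (labels t) (child-∈-labelsV ts ch-ts≡ v∈)

    parentInV-root : ∀ {j} p {v ws} (ts : Vec (Tree k n) j) → Unique (labelsV ts) →
                     node v ws ∈ toList ts → parentInV p v ts ≡ just p
    parentInV-root p {v} (t ∷ ts) u (here refl) with v ≟ v
    ... | yes _  = refl
    ... | no v≢v = ⊥-elim (v≢v refl)
    parentInV-root p (t ∷ ts) u (there v∈) with Unique-++⁻ (labels t) u
    ... | _ , u-ts , disjoint
      rewrite parentIn-∉ p t (λ v∈t → disjoint v∈t (root-∈-labelsV ts v∈)) = parentInV-root p ts u-ts v∈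

    mutual
      parentIn-child : ∀ p {u v ws cs} (t : Tree k n) → Unique (labels t) → childrenOf u t ≡ just cs →
                       node v ws ∈ cs → parentIn p v t ≡ just (just u)
      parentIn-child p {u} {v} (node w cs₀) (w∉ ∷ u-cs₀) ch≡ v∈ with u ≟ w | ch≡
      ... | yes refl | refl with v ≟ u
      ...   | yes refl = ⊥-elim (All.lookup w∉ (root-∈-labelsV cs₀ v∈) refl)
      ...   | no _     = parentInV-root (just u) cs₀ u-cs₀ v∈
      parentIn-child p {u} {v} (node w cs₀) (w∉ ∷ u-cs₀) ch≡ v∈ | no _ | ch-cs₀≡ with v ≟ w
      ...   | yes refl = ⊥-elim (All.lookup w∉ (child-∈-labelsV cs₀ ch-cs₀≡ v∈) refl)
      ...   | no _     = parentInV-child (just w) cs₀ u-cs₀ ch-cs₀≡ v∈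

      parentInV-child : ∀ {j} p {u v ws cs} (ts : Vec (Tree k n) j) → Unique (labelsV ts) →
                        childrenOfV u ts ≡ just cs → node v ws ∈ cs → parentInV p v ts ≡ just (just u)
      parentInV-child p {u} (t ∷ ts) u-tts ch≡ v∈ with Unique-++⁻ (labels t) u-tts
      ... | u-t , u-ts , disjoint with childrenOf u t in ch-t≡ | ch≡
      ...   | just _  | refl rewrite parentIn-child p t u-t ch-t≡ v∈ = refl
      ...   | nothing | ch-ts≡
        rewrite parentIn-∉ p t (λ v∈t → disjoint v∈t (child-∈-labelsV ts ch-ts≡ v∈)) =
          parentInV-child p ts u-ts ch-ts≡ v∈

    lastNode-∈ : ∀ (cs : List (Tree k n)) {v} → lastNode cs ≡ just v → ∃ λ ws → node v ws ∈ cs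
    lastNode-∈ (leaf ∷ cs) last≡ with ws , v∈ ← lastNode-∈ cs last≡ = ws , there v∈
    lastNode-∈ (node w ws ∷ cs) last≡ with lastNode cs in last-cs≡ | last≡
    ... | just _  | refl with ws′ , v∈ ← lastNode-∈ cs last-cs≡ = ws′ , there v∈
    ... | nothing | refl = ws , here refl

    cadet-parent : ∀ (T : Tree k n) u {v} → Unique (labels T) → cadet T u ≡ just v →
                   parentIn nothing v T ≡ just (just u)
    cadet-parent T u u-T cadet≡ with childrenOf u T in ch≡
    ... | just cs with ws , v∈ ← lastNode-∈ cs cadet≡ = parentIn-child nothing T u-T ch≡ v∈

    cadet-injective : ∀ (T : Tree k n) u u′ {v} → Unique (labels T) →
                      cadet T u ≡ just v → cadet T u′ ≡ just v → u ≡ u′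
    cadet-injective T u u′ u-T cadet≡ cadet′≡
      with refl ← trans (sym (cadet-parent T u u-T cadet≡)) (cadet-parent T u′ u-T cadet′≡) = refl

module CadetSequences where

  open import Data.Bool using (Bool; true; false; not; _∧_; _∨_) renaming (T to True)
  open import Data.Bool.ListAction using (all)
  open import Data.Bool.Properties using (T-≡; T-not-≡)
  open import Data.Empty using (⊥-elim)
  open import Data.Fin using (Fin; toℕ; inject≤)
  open import Data.Fin.Properties as Fin using (_≟_)
  open import Data.List using (List; []; _∷_; length; map; take; drop; lookup; allFin; head; last)
  open import Data.List.Membership.Propositional using (_∈_)
  open import Data.List.Membership.Propositional.Properties using (∈-allFin)
  import Data.List.Properties as List
  import Data.List.Relation.Unary.All as All
  import Data.List.Relation.Unary.All.Properties as All
  open import Data.List.Relation.Unary.Any using (here; there)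
  open import Data.List.Relation.Unary.Unique.Propositional using (Unique)
  open import Data.Maybe using (Maybe; just; nothing)
  open import Data.Nat using (ℕ; zero; suc; _<ᵇ_; _+_; _∸_; _⊓_; _≤_; _<_; z≤n; s≤s; pred)
  open import Data.Nat.ListAction using (sum)
  import Data.Nat.Properties as ℕ
  open import Data.Product using (∃; ∃₂; _×_; _,_; proj₁; proj₂)
  open import Data.Sum using (_⊎_; inj₁; inj₂; map₁)
  open import Data.Unit using (tt)
  open import Function.Bundles using (Equivalence)
  open import Relation.Binary.PropositionalEquality
    using (_≡_; refl; sym; trans; cong; cong₂; subst; subst₂; module ≡-Reasoning)
  open import Relation.Nullary using (yes; ¬_)
  import Algebra.Properties.CommutativeSemigroup ℕ.+-commutativeSemigroup as +-CS
  open TreeParents using (cadet-injective)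

  module _ {A : Set} where

    lookup? : List A → ℕ → Maybe A
    lookup? []       _       = nothing
    lookup? (x ∷ xs) zero    = just x
    lookup? (x ∷ xs) (suc p) = lookup? xs p

    slice : ℕ → ℕ → List A → List A
    slice s l xs = take l (drop s xs)

    lookup?⇒< : ∀ xs p {x} → lookup? xs p ≡ just x → p < length xs
    lookup?⇒< (y ∷ xs) zero    _      = s≤s z≤n
    lookup?⇒< (y ∷ xs) (suc p) xs[p]≡ = s≤s (lookup?⇒< xs p xs[p]≡)

    <⇒lookup? : ∀ xs p → p < length xs → ∃ λ x → lookup? xs p ≡ just x
    <⇒lookup? (y ∷ xs) zero    _         = y , refl
    <⇒lookup? (y ∷ xs) (suc p) (s≤s p<n) = <⇒lookup? xs p p<n

    lookup?-previous : ∀ xs p {x} → lookup? xs (suc p) ≡ just x → ∃ λ y → lookup? xs p ≡ just y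
    lookup?-previous (y ∷ xs) zero    _        = y , refl
    lookup?-previous (y ∷ xs) (suc p) xs[2+p]≡ = lookup?-previous xs p xs[2+p]≡

    lookup?-drop : ∀ s (xs : List A) p → lookup? (drop s xs) p ≡ lookup? xs (s + p)
    lookup?-drop zero    xs       p = refl
    lookup?-drop (suc s) []       p = refl
    lookup?-drop (suc s) (x ∷ xs) p = lookup?-drop s xs p

    drop-lookup? : ∀ xs p {x} → lookup? xs p ≡ just x → drop p xs ≡ x ∷ drop (suc p) xs
    drop-lookup? (y ∷ xs) zero    refl   = refl
    drop-lookup? (y ∷ xs) (suc p) xs[p]≡ = drop-lookup? xs p xs[p]≡

    ∈-take⁻ : ∀ l (xs : List A) {x} → x ∈ take l xs → ∃ λ p → p < l × lookup? xs p ≡ just x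
    ∈-take⁻ (suc l) (y ∷ xs) (here refl) = zero , s≤s z≤n , refl
    ∈-take⁻ (suc l) (y ∷ xs) (there x∈) with p , p<l , xs[p]≡ ← ∈-take⁻ l xs x∈ = suc p , s≤s p<l , xs[p]≡

    ∈-take⁺ : ∀ l (xs : List A) p {x} → p < l → lookup? xs p ≡ just x → x ∈ take l xs
    ∈-take⁺ (suc l) (y ∷ xs) zero    _         refl   = here refl
    ∈-take⁺ (suc l) (y ∷ xs) (suc p) (s≤s p<l) xs[p]≡ = there (∈-take⁺ l xs p p<l xs[p]≡)

    ∈-slice⁻ : ∀ s l (xs : List A) {x} → x ∈ slice s l xs → ∃ λ p → s ≤ p × p < s + l × lookup? xs p ≡ just x
    ∈-slice⁻ s l xs x∈ with q , q<l , eq ← ∈-take⁻ l (drop s xs) x∈ =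
      s + q , ℕ.m≤m+n s q , ℕ.+-monoʳ-< s q<l , trans (sym (lookup?-drop s xs q)) eq

    ∈-slice⁺ : ∀ s l (xs : List A) p {x} → s ≤ p → p < s + l → lookup? xs p ≡ just x → x ∈ slice s l xs
    ∈-slice⁺ s l xs p s≤p p<s+l xs[p]≡ with q , refl ← ℕ.m≤n⇒∃[o]m+o≡n s≤p =
      ∈-take⁺ l (drop s xs) q (ℕ.+-cancelˡ-< s q l p<s+l) (trans (lookup?-drop s xs q) xs[p]≡)

    slice-suc : ∀ xs s l {x} → lookup? xs s ≡ just x → slice s (suc l) xs ≡ x ∷ slice (suc s) l xs
    slice-suc xs s l xs[s]≡ rewrite drop-lookup? xs s xs[s]≡ = refl

    length-slice : ∀ s l (xs : List A) → s + l ≤ length xs → length (slice s l xs) ≡ l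
    length-slice s l xs s+l≤n = begin
      length (take l (drop s xs))  ≡⟨ List.length-take l (drop s xs) ⟩
      l ⊓ length (drop s xs)       ≡⟨ cong (l ⊓_) (List.length-drop s xs) ⟩
      l ⊓ (length xs ∸ s)          ≡⟨ ℕ.m≤n⇒m⊓n≡m l≤n∸s ⟩
      l                            ∎
      where
      open ≡-Reasoning
      l≤n∸s : l ≤ length xs ∸ s
      l≤n∸s = subst (_≤ length xs ∸ s) (ℕ.m+n∸m≡n s l) (ℕ.∸-monoˡ-≤ s s+l≤n)

    take-slice : ∀ s l l′ (xs : List A) → l′ ≤ l → take l′ (slice s l xs) ≡ slice s l′ xs
    take-slice s l l′ xs l′≤l
      rewrite List.take-take l′ l (drop s xs) | ℕ.m≤n⇒m⊓n≡m l′≤l = refl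

    slice-take : ∀ s l m (xs : List A) → s + l ≤ m → slice s l (take m xs) ≡ slice s l xs
    slice-take s l m xs s+l≤m = begin
      take l (drop s (take m xs))        ≡⟨ List.take-drop l s (take m xs) ⟩
      drop s (take (s + l) (take m xs))  ≡⟨ cong (drop s) (List.take-take (s + l) m xs) ⟩
      drop s (take ((s + l) ⊓ m) xs)     ≡⟨ cong (λ t → drop s (take t xs)) (ℕ.m≤n⇒m⊓n≡m s+l≤m) ⟩
      drop s (take (s + l) xs)           ≡⟨ sym (List.take-drop l s xs) ⟩
      take l (drop s xs)                 ∎
      where open ≡-Reasoning

    length-take-≤ : ∀ m (xs : List A) → length (take m xs) ≤ m
    length-take-≤ m xs = subst (_≤ m) (sym (List.length-take m xs)) (ℕ.m⊓n≤m m (length xs))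

    length-take-≤-length : ∀ m (xs : List A) → length (take m xs) ≤ length xs
    length-take-≤-length m xs = subst (_≤ length xs) (sym (List.length-take m xs)) (ℕ.m⊓n≤n m (length xs))

    lookup-take : ∀ m (xs : List A) i →
                  lookup (take m xs) i ≡ lookup xs (inject≤ i (length-take-≤-length m xs))
    lookup-take (suc m) (x ∷ xs) Fin.zero    = refl
    lookup-take (suc m) (x ∷ xs) (Fin.suc i) = lookup-take m xs i

  private
    ∧-true⁻ : ∀ {a b} → a ∧ b ≡ true → a ≡ true × b ≡ true
    ∧-true⁻ {true} b≡true = refl , b≡true

    not-∨-elim : ∀ {b c} → True (not b ∨ c) → True b → True c
    not-∨-elim {true} c _ = c

    not-∨-intro : ∀ {b c} → (True b → True c) → True (not b ∨ c)
    not-∨-intro {false} _   = tt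
    not-∨-intro {true}  b⇒c = b⇒c tt

  module _ {k n : ℕ} (S : Deformation n) (T : Tree k n) where

    SCadetPairs : List (Fin n) → Set
    SCadetPairs vs = ∀ (i j : Fin (length vs)) → toℕ i < toℕ j →
                     SMinusᵇ S (lookup vs i) (lookup vs j) (lsibSum T vs i j) ≡ false

    private
      pairOkᵇ : (vs : List (Fin n)) → Fin (length vs) → Fin (length vs) → Bool
      pairOkᵇ vs i j = not (toℕ i <ᵇ toℕ j) ∨ not (SMinusᵇ S (lookup vs i) (lookup vs j) (lsibSum T vs i j))

    SCadetᵇ⇒ : ∀ vs → SCadetᵇ S T vs ≡ true → CadetSeqᵇ T vs ≡ true × SCadetPairs vs
    SCadetᵇ⇒ vs sc≡true with cadet≡true , pairs≡true ← ∧-true⁻ {CadetSeqᵇ T vs} sc≡true =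
      cadet≡true , pairs
      where
      row : ∀ i → True (all (pairOkᵇ vs i) (allFin (length vs)))
      row i = All.lookup (All.all⁺ (λ i → all (pairOkᵇ vs i) (allFin (length vs))) (allFin (length vs))
                                   (Equivalence.from T-≡ pairs≡true))
                         (∈-allFin i)
      pairs : SCadetPairs vs
      pairs i j i<j = Equivalence.to T-not-≡ (not-∨-elim
        (All.lookup (All.all⁺ (pairOkᵇ vs i) (allFin (length vs)) (row i)) (∈-allFin j)) (ℕ.<⇒<ᵇ i<j))

    SCadetᵇ⇐ : ∀ vs → CadetSeqᵇ T vs ≡ true → SCadetPairs vs → SCadetᵇ S T vs ≡ true
    SCadetᵇ⇐ vs cadet≡true pairs rewrite cadet≡true =
      Equivalence.to T-≡ (All.all⁻ (λ i → all (pairOkᵇ vs i) (allFin (length vs))) {xs = allFin (length vs)}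
        (All.tabulate λ {i} _ → All.all⁻ (pairOkᵇ vs i) {xs = allFin (length vs)} (All.tabulate λ {j} _ →
        not-∨-intro (λ i<ᵇj → Equivalence.from T-not-≡ (pairs i j (ℕ.<ᵇ⇒< (toℕ i) (toℕ j) i<ᵇj))))))

    SCadetᵇ-tail : ∀ v w ws → SCadetᵇ S T (v ∷ w ∷ ws) ≡ true → SCadetᵇ S T (w ∷ ws) ≡ true
    SCadetᵇ-tail v w ws sc≡true with cadet≡true , pairs ← SCadetᵇ⇒ (v ∷ w ∷ ws) sc≡true =
      SCadetᵇ⇐ (w ∷ ws) (proj₂ (∧-true⁻ {isCadetOfᵇ T v w} cadet≡true))
        (λ i j i<j → pairs (Fin.suc i) (Fin.suc j) (s≤s i<j))

    linkedᵇ-take : ∀ v vs m → linkedᵇ T v vs ≡ true → linkedᵇ T v (take m vs) ≡ true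
    linkedᵇ-take v []       zero    _ = refl
    linkedᵇ-take v []       (suc m) _ = refl
    linkedᵇ-take v (w ∷ vs) zero    _ = refl
    linkedᵇ-take v (w ∷ vs) (suc m) linked with v→w , linked′ ← ∧-true⁻ {isCadetOfᵇ T v w} linked
      rewrite v→w = linkedᵇ-take w vs m linked′

    SCadetᵇ-take : ∀ vs m → SCadetᵇ S T vs ≡ true → SCadetᵇ S T (take (suc m) vs) ≡ true
    SCadetᵇ-take (v ∷ vs) m sc≡true with cadet≡true , pairs ← SCadetᵇ⇒ (v ∷ vs) sc≡true =
      SCadetᵇ⇐ (take (suc m) (v ∷ vs)) (linkedᵇ-take v vs m cadet≡true) pairs′
      where
      ws : List (Fin n)
      ws = take (suc m) (v ∷ vs)
      ≤len : length ws ≤ length (v ∷ vs)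
      ≤len = length-take-≤-length (suc m) (v ∷ vs)
      pairs′ : SCadetPairs ws
      pairs′ i j i<j = begin
        SMinusᵇ S (lookup ws i) (lookup ws j) (lsibSum T ws i j)
          ≡⟨ cong₂ (λ x y → SMinusᵇ S x y (lsibSum T ws i j))
                   (lookup-take (suc m) (v ∷ vs) i) (lookup-take (suc m) (v ∷ vs) j) ⟩
        SMinusᵇ S (lookup (v ∷ vs) i′) (lookup (v ∷ vs) j′) (lsibSum T ws i j)
          ≡⟨ cong (SMinusᵇ S (lookup (v ∷ vs) i′) (lookup (v ∷ vs) j′)) window ⟩
        SMinusᵇ S (lookup (v ∷ vs) i′) (lookup (v ∷ vs) j′) (lsibSum T (v ∷ vs) i′ j′)
          ≡⟨ pairs i′ j′ (subst₂ _<_ (sym (Fin.toℕ-inject≤ i ≤len)) (sym (Fin.toℕ-inject≤ j ≤len)) i<j) ⟩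
        false ∎
        where
        open ≡-Reasoning
        i′ j′ : Fin (length (v ∷ vs))
        i′ = inject≤ i ≤len
        j′ = inject≤ j ≤len
        in-range : suc (toℕ i) + (toℕ j ∸ toℕ i) ≤ suc m
        in-range = ℕ.≤-trans (ℕ.≤-reflexive (cong suc (ℕ.m+[n∸m]≡n (ℕ.<⇒≤ i<j))))
                             (ℕ.≤-trans (Fin.toℕ<n j) (length-take-≤ (suc m) (v ∷ vs)))
        window : lsibSum T ws i j ≡ lsibSum T (v ∷ vs) i′ j′
        window rewrite Fin.toℕ-inject≤ i ≤len | Fin.toℕ-inject≤ j ≤len =
          cong (λ us → sum (map (lsib T) us))
            (slice-take (suc (toℕ i)) (toℕ j ∸ toℕ i) (suc m) (v ∷ vs) in-range)

    SCadetᵇ-take-false : ∀ vs m → SCadetᵇ S T (take (suc m) vs) ≡ false → SCadetᵇ S T vs ≡ false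
    SCadetᵇ-take-false vs m prefix≡false with SCadetᵇ S T vs in sc≡
    ... | false = refl
    ... | true with () ← trans (sym (SCadetᵇ-take vs m sc≡)) prefix≡false

  extend-while : ∀ (P : ℕ → Bool) N → P 0 ≡ true → ∃ λ d → d ≤ N × P d ≡ true × (d ≡ N ⊎ P (suc d) ≡ false)
  extend-while P zero    P0 = 0 , z≤n , P0 , inj₁ refl
  extend-while P (suc N) P0 with P 1 in P1
  ... | false = 0 , z≤n , P0 , inj₂ P1
  ... | true with d , d≤N , Pd , stop ← extend-while (λ d → P (suc d)) N P1 =
    suc d , s≤s d≤N , Pd , map₁ (cong suc) stop

  module _ {k n : ℕ} (S : Deformation n) (T : Tree k n) (M : List (Fin n)) where

    record MaximalSCadetSlice (s l : ℕ) : Set where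
      field
        bound         : s + l ≤ length M
        scadet        : SCadetᵇ S T (slice s l M) ≡ true
        left-maximal  : s ≡ 0 ⊎ SCadetᵇ S T (slice (pred s) (suc l) M) ≡ false
        right-maximal : s + l ≡ length M ⊎ SCadetᵇ S T (slice s (suc l) M) ≡ false

    extend-to-maximal : ∀ s l → s + l ≤ length M → SCadetᵇ S T (slice s l M) ≡ true →
                        ∃₂ λ s′ l′ → s′ ≤ s × s + l ≤ s′ + l′ × MaximalSCadetSlice s′ l′
    extend-to-maximal s l s+l≤ sc
      with dₗ , dₗ≤s , scₗ , stopₗ ← extend-while (λ d → SCadetᵇ S T (slice (s ∸ d) (d + l) M)) s sc
      with dᵣ , dᵣ≤ , scᵣ , stopᵣ ←
             extend-while (λ d → SCadetᵇ S T (slice (s ∸ dₗ) (d + (dₗ + l)) M)) (length M ∸ (s + l)) scₗ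
      = s ∸ dₗ , dᵣ + (dₗ + l) , ℕ.m∸n≤m s dₗ , covers ,
        record { bound = bound ; scadet = scᵣ ; left-maximal = left-maximal ; right-maximal = right-maximal }
      where
      s′ l′ : ℕ
      s′ = s ∸ dₗ
      l′ = dᵣ + (dₗ + l)
      start : s′ + (dₗ + l) ≡ s + l
      start = trans (sym (ℕ.+-assoc s′ dₗ l)) (cong (_+ l) (ℕ.m∸n+n≡m dₗ≤s))
      reorder : s′ + l′ ≡ dᵣ + (s + l)
      reorder = trans (+-CS.x∙yz≈y∙xz s′ dᵣ (dₗ + l)) (cong (dᵣ +_) start)
      covers : s + l ≤ s′ + l′
      covers = subst (_≤ s′ + l′) start (ℕ.+-monoʳ-≤ s′ (ℕ.m≤n+m (dₗ + l) dᵣ))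
      bound : s′ + l′ ≤ length M
      bound = subst (_≤ length M) (sym reorder)
                (subst (dᵣ + (s + l) ≤_) (ℕ.m∸n+n≡m s+l≤) (ℕ.+-monoˡ-≤ (s + l) dᵣ≤))
      left-maximal : s′ ≡ 0 ⊎ SCadetᵇ S T (slice (pred s′) (suc l′) M) ≡ false
      left-maximal = left-maximal′ stopₗ
        where
        left-maximal′ : dₗ ≡ s ⊎ SCadetᵇ S T (slice (s ∸ suc dₗ) (suc (dₗ + l)) M) ≡ false →
                        s′ ≡ 0 ⊎ SCadetᵇ S T (slice (pred s′) (suc l′) M) ≡ false
        left-maximal′ (inj₁ dₗ≡s) = inj₁ (trans (cong (s ∸_) dₗ≡s) (ℕ.n∸n≡0 s))
        left-maximal′ (inj₂ stuck) rewrite ℕ.pred[m∸n]≡m∸[1+n] s dₗ =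
          inj₂ (SCadetᵇ-take-false S T (slice (s ∸ suc dₗ) (suc l′) M) (dₗ + l)
                 (trans (cong (SCadetᵇ S T) (take-slice (s ∸ suc dₗ) (suc l′) (suc (dₗ + l)) M
                                                         (s≤s (ℕ.m≤n+m (dₗ + l) dᵣ))))
                        stuck))
      right-maximal : s′ + l′ ≡ length M ⊎ SCadetᵇ S T (slice s′ (suc l′) M) ≡ false
      right-maximal =
        map₁ (λ dᵣ≡ → trans reorder (trans (cong (_+ (s + l)) dᵣ≡) (ℕ.m∸n+n≡m s+l≤))) stopᵣ

  module _ {k n : ℕ} (T : Tree k n) where

    isCadetOfᵇ-sound : ∀ u v → isCadetOfᵇ T u v ≡ true → cadet T u ≡ just v
    isCadetOfᵇ-sound u v u→v with cadet T u
    ... | just w with w ≟ v | u→v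
    ...   | yes refl | _ = refl

    linkedᵇ-step : ∀ x xs p {y z} → linkedᵇ T x xs ≡ true →
                   lookup? (x ∷ xs) p ≡ just y → lookup? (x ∷ xs) (suc p) ≡ just z → cadet T y ≡ just z
    linkedᵇ-step x (w ∷ xs) zero    linked refl refl =
      isCadetOfᵇ-sound x w (proj₁ (∧-true⁻ {isCadetOfᵇ T x w} linked))
    linkedᵇ-step x (w ∷ xs) (suc p) linked y≡ z≡ =
      linkedᵇ-step w xs p (proj₂ (∧-true⁻ {isCadetOfᵇ T x w} linked)) y≡ z≡

    CadetSeqᵇ-step : ∀ N p {y z} → CadetSeqᵇ T N ≡ true →
                     lookup? N p ≡ just y → lookup? N (suc p) ≡ just z → cadet T y ≡ just z
    CadetSeqᵇ-step (x ∷ xs) p = linkedᵇ-step x xs p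

  private
    last-lookup? : ∀ {A : Set} (xs : List A) p {x} → lookup? xs p ≡ just x → lookup? xs (suc p) ≡ nothing →
                   last xs ≡ just x
    last-lookup? (y ∷ [])     zero    refl _     = refl
    last-lookup? (y ∷ z ∷ xs) (suc p) x≡   after = last-lookup? (z ∷ xs) p x≡ after

    head-lookup? : ∀ {A : Set} (xs : List A) {x} → lookup? xs 0 ≡ just x → head xs ≡ just x
    head-lookup? (y ∷ xs) refl = refl

  module MaximalCadetSequence {k n : ℕ} (T : Tree k n) (unique : Unique (labels T))
                              (M : List (Fin n)) (maxM : MaxCadetSeq T M) where

    cadet-step : ∀ p {y z} → lookup? M p ≡ just y → lookup? M (suc p) ≡ just z → cadet T y ≡ just z
    cadet-step p = CadetSeqᵇ-step T M p (proj₁ maxM)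

    last-has-no-cadet : ∀ p {y} → lookup? M p ≡ just y → lookup? M (suc p) ≡ nothing → cadet T y ≡ nothing
    last-has-no-cadet p y≡ after = proj₁ (proj₂ maxM) _ (last-lookup? M p y≡ after)

    head-is-no-cadet : ∀ u {x} → lookup? M 0 ≡ just x → ¬ cadet T u ≡ just x
    head-is-no-cadet u x≡ = proj₂ (proj₂ maxM) u _ (head-lookup? M x≡)

    position-unique : ∀ p q {x} → lookup? M p ≡ just x → lookup? M q ≡ just x → p ≡ q
    position-unique zero    zero    _  _  = refl
    position-unique zero    (suc q) x≡ x≡′ with y , y≡ ← lookup?-previous M q x≡′
      = ⊥-elim (head-is-no-cadet y x≡ (cadet-step q y≡ x≡′))
    position-unique (suc p) zero    x≡ x≡′ with y , y≡ ← lookup?-previous M p x≡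
      = ⊥-elim (head-is-no-cadet y x≡′ (cadet-step p y≡ x≡))
    position-unique (suc p) (suc q) x≡ x≡′
      with y , y≡ ← lookup?-previous M p x≡ | y′ , y′≡ ← lookup?-previous M q x≡′
      with refl ← cadet-injective T y y′ unique (cadet-step p y≡ x≡) (cadet-step q y′≡ x≡′)
      = cong suc (position-unique p q y≡ y′≡)

    linked-is-slice : ∀ x zs p → linkedᵇ T x zs ≡ true → lookup? M p ≡ just x →
                      p + suc (length zs) ≤ length M × x ∷ zs ≡ slice p (suc (length zs)) M
    linked-is-slice x [] p _ x≡ =
      subst (_≤ length M) (ℕ.+-comm 1 p) (lookup?⇒< M p x≡) , sym (slice-suc M p 0 x≡)
    linked-is-slice x (z ∷ zs) p linked x≡ with x→z , linked′ ← ∧-true⁻ {isCadetOfᵇ T x z} linked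
                                               | lookup? M (suc p) in next≡
    ... | nothing with () ← trans (sym (isCadetOfᵇ-sound T x z x→z)) (last-has-no-cadet p x≡ next≡)
    ... | just y with refl ← trans (sym (isCadetOfᵇ-sound T x z x→z)) (cadet-step p x≡ next≡)
      with bound , z∷zs≡ ← linked-is-slice z zs (suc p) linked′ next≡ =
      subst (_≤ length M) (sym (ℕ.+-suc p (suc (length zs)))) bound ,
      trans (cong (x ∷_) z∷zs≡) (sym (slice-suc M p (suc (length zs)) x≡))

    cadetSeq-is-slice : ∀ ys {c p} → CadetSeqᵇ T ys ≡ true → c ∈ ys → lookup? M p ≡ just c →
                        ∃ λ s → s + length ys ≤ length M × ys ≡ slice s (length ys) M
    cadetSeq-is-slice (y ∷ ys) {p = p} linked (here refl) y≡ = p , linked-is-slice y ys p linked y≡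
    cadetSeq-is-slice (y ∷ y′ ∷ ys) linked (there c∈) c≡
      with y→y′ , linked′ ← ∧-true⁻ {isCadetOfᵇ T y y′} linked
      with cadetSeq-is-slice (y′ ∷ ys) linked′ c∈ c≡
    ... | s , bound , y′∷ys≡ with w , w≡ ← <⇒lookup? M s (ℕ.<-≤-trans (ℕ.m<m+n s (s≤s z≤n)) bound)
      with refl ← List.∷-injectiveˡ (trans y′∷ys≡ (slice-suc M s (length ys) w≡))
      with s
    ...   | zero   = ⊥-elim (head-is-no-cadet y w≡ (isCadetOfᵇ-sound T y y′ y→y′))
    ...   | suc s′ with x , x≡ ← lookup?-previous M s′ w≡
      with refl ← cadet-injective T y x unique (isCadetOfᵇ-sound T y y′ y→y′) (cadet-step s′ x≡ w≡) =
      s′ , subst (_≤ length M) (sym (ℕ.+-suc s′ (suc (length ys)))) bound ,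
      trans (cong (y ∷_) y′∷ys≡) (sym (slice-suc M s′ (suc (length ys)) x≡))

    slice-start-unique : ∀ s s′ l → s < length M → s′ < length M →
                         slice s (suc l) M ≡ slice s′ (suc l) M → s ≡ s′
    slice-start-unique s s′ l s<n s′<n slices≡
      with x , x≡ ← <⇒lookup? M s s<n | x′ , x′≡ ← <⇒lookup? M s′ s′<n
      with refl ← List.∷-injectiveˡ (trans (sym (slice-suc M s l x≡)) (trans slices≡ (slice-suc M s′ l x′≡)))
      = position-unique s s′ x≡ x′≡

open import Data.Bool using (Bool; true; false; if_then_else_)
open import Data.Bool.Properties as Bool using (⇔→≡; ¬-not)
open import Data.Empty using (⊥-elim)
open import Data.Fin using (Fin; toℕ; fromℕ<)
import Data.Fin.Properties as Fin
open import Data.Integer using (ℤ; 0ℤ; -1ℤ; _*_; _^_)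
import Data.Integer.Properties as ℤ
open import Data.List using (List; []; _∷_; length; allFin; take; drop)
open import Data.List.Membership.Propositional using (_∈_; _∉_; find; lose)
open import Data.List.Membership.Propositional.Properties using (∈-allFin)
import Data.List.Properties as List
open import Data.List.Relation.Binary.Permutation.Propositional using (_↭_; ↭-prep; ↭-sym; ↭⇒↭ₛ)
open import Data.List.Relation.Binary.Permutation.Propositional.Properties using (∈-resp-↭; drop-∷; ↭-length)
import Data.List.Relation.Binary.Permutation.Setoid.Properties as ↭ₛ
import Data.List.Relation.Unary.AllPairs as AllPairs
open import Data.List.Relation.Unary.Any using (Any; any?; here; there)
open import Data.List.Relation.Unary.Unique.Propositional using (Unique)
open import Data.List.Relation.Unary.Unique.Propositional.Properties using (allFin⁺; Unique[x∷xs]⇒x∉xs)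
open import Data.Maybe using (just)
open import Data.Nat using (ℕ; zero; suc; pred; _+_; _∸_; _≤_; _<_; s≤s; z≤n)
import Data.Nat.Properties as ℕ
open import Data.Product using (Σ; ∃; _×_; _,_; proj₁; proj₂)
open import Data.Sum using (_⊎_; inj₁; inj₂; [_,_]′)
open import Function.Bundles using (mk⇔)
open import Relation.Binary.PropositionalEquality
  using (_≡_; _≢_; refl; sym; trans; cong; subst; subst₂; setoid; module ≡-Reasoning)
open import Relation.Nullary using (¬_; Dec; yes; no)
open import Relation.Nullary.Decidable using (_×-dec_; _⊎-dec_; ¬?)

open SetPartitionSums
open CadetSequences

module Isolated {k n : ℕ} (S : Deformation n) (T : Tree k n) (unique : Unique (labels T))
                (M : List (Fin n)) (maxM : MaxCadetSeq T M) (i L₀ : ℕ)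
                (bound : i + suc (suc L₀) ≤ length M)
                (C-scadet : SCadetᵇ S T (slice i (suc (suc L₀)) M) ≡ true)
                (isolated : ∀ s l → MaximalSCadetSlice S T M s l →
                            Any (_∈ slice s l M) (slice i (suc (suc L₀)) M) →
                            slice s l M ≡ slice i (suc (suc L₀)) M)
                where

  open MaximalCadetSequence T unique M maxM

  private
    L : ℕ
    L = suc (suc L₀)

    C : List (Fin n)
    C = slice i L M

    i<n : i < length M
    i<n = ℕ.<-≤-trans (ℕ.m<m+n i (s≤s z≤n)) bound

    1+i<n : suc i < length M
    1+i<n = ℕ.<-≤-trans (subst (suc i <_) (sym (ℕ.+-suc i (suc L₀))) (s≤s (ℕ.m<m+n i (s≤s z≤n)))) bound

    a b : Fin n
    a = proj₁ (<⇒lookup? M i i<n)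
    b = proj₁ (<⇒lookup? M (suc i) 1+i<n)

    M[i]≡a : lookup? M i ≡ just a
    M[i]≡a = proj₂ (<⇒lookup? M i i<n)

    M[1+i]≡b : lookup? M (suc i) ≡ just b
    M[1+i]≡b = proj₂ (<⇒lookup? M (suc i) 1+i<n)

  slice-from-a : ∀ m → slice i (suc (suc m)) M ≡ a ∷ b ∷ slice (suc (suc i)) m M
  slice-from-a m = trans (slice-suc M i (suc m) M[i]≡a) (cong (a ∷_) (slice-suc M (suc i) m M[1+i]≡b))

  a∈C : a ∈ C
  a∈C = subst (a ∈_) (sym (slice-from-a L₀)) (here refl)

  b∈C : b ∈ C
  b∈C = subst (b ∈_) (sym (slice-from-a L₀)) (there (here refl))

  a≢b : a ≢ b
  a≢b a≡b = ℕ.1+n≢n (sym (position-unique i (suc i) M[i]≡a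
                             (subst (λ x → lookup? M (suc i) ≡ just x) (sym a≡b) M[1+i]≡b)))

  maximal-meeting-C-is-C : ∀ {s l c} → MaximalSCadetSlice S T M s l → c ∈ slice s l M → c ∈ C → s ≡ i × l ≡ L
  maximal-meeting-C-is-C {s} {l} maximal c∈ c∈C = s≡i , l≡L
    where
    open MaximalSCadetSlice maximal using () renaming (bound to s+l≤)
    maximal≡C : slice s l M ≡ C
    maximal≡C = isolated s l maximal (lose c∈C c∈)
    l≡L : l ≡ L
    l≡L = trans (sym (length-slice s l M s+l≤)) (trans (cong length maximal≡C) (length-slice i L M bound))
    s≡i : s ≡ i
    s≡i = slice-start-unique s i (suc L₀)
      (ℕ.<-≤-trans (ℕ.m<m+n s (s≤s z≤n)) (subst (λ l → s + l ≤ length M) l≡L s+l≤)) i<n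
      (subst (λ l → slice s l M ≡ C) l≡L maximal≡C)

  within-C : ∀ ys {c} → SCadetᵇ S T ys ≡ true → c ∈ ys → c ∈ C →
             ∃ λ s → i ≤ s × s + length ys ≤ i + L × ys ≡ slice s (length ys) M
  within-C ys {c} sc c∈ys c∈C =
    let p , _ , _ , M[p]≡c = ∈-slice⁻ i L M c∈C
        s , s+l≤ , ys≡ = cadetSeq-is-slice ys (proj₁ (SCadetᵇ⇒ S T ys sc)) c∈ys M[p]≡c
        s′ , l′ , s′≤s , covers , maximal =
          extend-to-maximal S T M s (length ys) s+l≤ (subst (λ zs → SCadetᵇ S T zs ≡ true) ys≡ sc)
        q , s≤q , q<s+l , M[q]≡c = ∈-slice⁻ s (length ys) M (subst (c ∈_) ys≡ c∈ys)
        s′≡i , l′≡L = maximal-meeting-C-is-C maximal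
          (∈-slice⁺ s′ l′ M q (ℕ.≤-trans s′≤s s≤q) (ℕ.<-≤-trans q<s+l covers) M[q]≡c) c∈C
    in s , subst (_≤ s) s′≡i s′≤s , subst₂ (λ u v → s + length ys ≤ u + v) s′≡i l′≡L covers , ys≡

  starts-at-a : ∀ ys → SCadetᵇ S T ys ≡ true → a ∈ ys → ys ≡ slice i (length ys) M × length ys ≤ L
  starts-at-a ys sc a∈ys =
    let s , i≤s , s+l≤ , ys≡ = within-C ys sc a∈ys a∈C
        q , s≤q , _ , M[q]≡a = ∈-slice⁻ s (length ys) M (subst (a ∈_) ys≡ a∈ys)
        s≡i = ℕ.≤-antisym (subst (s ≤_) (position-unique q i M[q]≡a M[i]≡a) s≤q) i≤s
    in subst (λ t → ys ≡ slice t (length ys) M) s≡i ys≡ ,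
       ℕ.+-cancelˡ-≤ i (length ys) L (subst (λ t → t + length ys ≤ i + L) s≡i s+l≤)

  private
    good : List (Fin n) → Bool
    good = SCadetBlockᵇ S T

  good-a∷⁻ : ∀ β → β ≢ [] → good (a ∷ β) ≡ true → b ∈ β × good β ≡ true
  good-a∷⁻ []      β≢[] _      = ⊥-elim (β≢[] refl)
  good-a∷⁻ (x ∷ β) _    good≡ =
    let ys , ys↭ , sc = any-permutations⁻ (SCadetᵇ S T) (a ∷ x ∷ β) good≡
        ys≡ , _ = starts-at-a ys sc (∈-resp-↭ (↭-sym ys↭) (here refl))
        ys≡a∷b∷ = trans ys≡ (trans (cong (λ l → slice i l M) (↭-length ys↭)) (slice-from-a (length β)))
        b∷↭x∷β = drop-∷ (subst (_↭ a ∷ x ∷ β) ys≡a∷b∷ ys↭)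
    in ∈-resp-↭ b∷↭x∷β (here refl) ,
       any-permutations⁺ (SCadetᵇ S T) (x ∷ β) b∷↭x∷β
         (SCadetᵇ-tail S T a b (slice (suc (suc i)) (length β) M)
                       (subst (λ zs → SCadetᵇ S T zs ≡ true) ys≡a∷b∷ sc))

  good-a∷⁺ : ∀ β → a ∉ β → b ∈ β → good β ≡ true → good (a ∷ β) ≡ true
  good-a∷⁺ β a∉β b∈β good≡ =
    let ys , ys↭β , sc = any-permutations⁻ (SCadetᵇ S T) β good≡
        b∈ys = ∈-resp-↭ (↭-sym ys↭β) b∈β
        s , i≤s , s+l≤ , ys≡ = within-C ys sc b∈ys b∈C
        q , s≤q , q<s+l , M[q]≡b = ∈-slice⁻ s (length ys) M (subst (b ∈_) ys≡ b∈ys)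
        q≡1+i = position-unique q (suc i) M[q]≡b M[1+i]≡b
    in [ (λ i<s → prepend-a ys ys↭β sc (ℕ.≤-antisym (subst (s ≤_) q≡1+i s≤q) i<s) s+l≤ ys≡)
                , (λ i≡s → ⊥-elim (a∉β (∈-resp-↭ ys↭β (subst (a ∈_) (sym ys≡)
                    (∈-slice⁺ s (length ys) M i (ℕ.≤-reflexive (sym i≡s))
                              (ℕ.<-trans (ℕ.n<1+n i) (subst (_< s + length ys) q≡1+i q<s+l)) M[i]≡a)))))
                ]′ (ℕ.m≤n⇒m<n∨m≡n i≤s)
    where
    prepend-a : ∀ ys → ys ↭ β → SCadetᵇ S T ys ≡ true → ∀ {s} → s ≡ suc i → s + length ys ≤ i + L →
                ys ≡ slice s (length ys) M → good (a ∷ β) ≡ true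
    prepend-a ys ys↭β sc refl s+l≤ ys≡ = any-permutations⁺ (SCadetᵇ S T) (a ∷ β) (↭-prep a ys↭β)
      (subst (λ zs → SCadetᵇ S T zs ≡ true) a∷ys≡ (SCadetᵇ-take S T C (length ys) C-scadet))
      where
      1+l≤L : suc (length ys) ≤ L
      1+l≤L = ℕ.+-cancelˡ-≤ i (suc (length ys)) L (subst (_≤ i + L) (sym (ℕ.+-suc i (length ys))) s+l≤)
      a∷ys≡ : take (suc (length ys)) C ≡ a ∷ ys
      a∷ys≡ = trans (take-slice i L (suc (length ys)) M 1+l≤L)
                    (trans (slice-suc M i (length ys) M[i]≡a) (cong (a ∷_) (sym ys≡)))

  rS≡0 : rS S T ≡ 0ℤ
  rS≡0 = begin
    rS S T
      ≡⟨ ∑-filter-all-good good n (allFin n) (ℕ.≤-reflexive (List.length-tabulate (λ x → x))) ⟩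
    -1ℤ ^ n * ∑[ ∏[ sign ] ] (setPartitions (allFin n))
      ≡⟨ cong (-1ℤ ^ n *_) (∑-setPartitions-↭ allFin↭ (∏-invariant sign-resp-↭)) ⟩
    -1ℤ ^ n * ∑[ ∏[ sign ] ] (setPartitions (a ∷ b ∷ rest))
      ≡⟨ cong (-1ℤ ^ n *_) (∑∏-setPartitions-toggle sign a b rest b∉rest refl keep kill) ⟩
    -1ℤ ^ n * 0ℤ
      ≡⟨ ℤ.*-zeroʳ (-1ℤ ^ n) ⟩
    0ℤ ∎
    where
    open ≡-Reasoning
    sign : List (Fin n) → ℤ
    sign β = if good β then -1ℤ else 0ℤ
    sign-resp-↭ : ∀ {β β′} → β ↭ β′ → sign β ≡ sign β′
    sign-resp-↭ β↭β′ = cong (λ g → if g then -1ℤ else 0ℤ) (any-permutations-resp-↭ (SCadetᵇ S T) β↭β′)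
    rest : List (Fin n)
    rest = proj₁ (pick-two (∈-allFin a) (∈-allFin b) a≢b)
    allFin↭ : allFin n ↭ a ∷ b ∷ rest
    allFin↭ = proj₂ (pick-two (∈-allFin a) (∈-allFin b) a≢b)
    unique-a∷b∷rest : Unique (a ∷ b ∷ rest)
    unique-a∷b∷rest = ↭ₛ.Unique-resp-↭ (setoid (Fin n)) (↭⇒↭ₛ allFin↭) (allFin⁺ n)
    a∉b∷rest : a ∉ b ∷ rest
    a∉b∷rest = Unique[x∷xs]⇒x∉xs unique-a∷b∷rest
    b∉rest : b ∉ rest
    b∉rest = Unique[x∷xs]⇒x∉xs (AllPairs.tail unique-a∷b∷rest)
    keep : ∀ {β} → BlockOf (b ∷ rest) β → b ∈ β → sign (a ∷ β) ≡ sign β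
    keep {β} (β≢[] , β⊆) b∈β = cong (λ g → if g then -1ℤ else 0ℤ)
      (⇔→≡ {z = true} (mk⇔ (λ good≡ → proj₂ (good-a∷⁻ β β≢[] good≡))
                            (good-a∷⁺ β (λ a∈β → a∉b∷rest (β⊆ a∈β)) b∈β)))
    kill : ∀ {β} → BlockOf rest β → sign (a ∷ β) ≡ 0ℤ
    kill {β} (β≢[] , β⊆) = cong (λ g → if g then -1ℤ else 0ℤ)
      (¬-not (λ good≡ → b∉rest (β⊆ (proj₁ (good-a∷⁻ β β≢[] good≡)))))

module _ {k n : ℕ} (S : Deformation n) (T : Tree k n) (M : List (Fin n)) where

  IsMaxSCadetSegment : ℕ → ℕ → Set
  IsMaxSCadetSegment i j =
    (i ≤ j) × (j < length M) × (SCadetᵇ S T (segment {k} M i j) ≡ true) ×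
    (i ≡ 0 ⊎ SCadetᵇ S T (segment {k} M (pred i) j) ≡ false) ×
    (suc j ≡ length M ⊎ SCadetᵇ S T (segment {k} M i (suc j)) ≡ false)

  segment-slice : ∀ s l → segment {k} M s (s + l) ≡ slice s (suc l) M
  segment-slice s l =
    cong (λ m → take m (drop s M)) (trans (cong (_∸ s) (sym (ℕ.+-suc s l))) (ℕ.m+n∸m≡n s (suc l)))

  maximal⇒segment : ∀ s l → MaximalSCadetSlice S T M s (suc l) → IsMaxSCadetSegment s (s + l)
  maximal⇒segment s l maximal =
    ℕ.m≤m+n s l , subst (_≤ length M) (ℕ.+-suc s l) bound ,
    subst (λ zs → SCadetᵇ S T zs ≡ true) (sym (segment-slice s l)) scadet ,
    left s left-maximal , right right-maximal
    where
    open MaximalSCadetSlice maximal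
    left : ∀ t → t ≡ 0 ⊎ SCadetᵇ S T (slice (pred t) (suc (suc l)) M) ≡ false →
           t ≡ 0 ⊎ SCadetᵇ S T (segment {k} M (pred t) (t + l)) ≡ false
    left zero     _            = inj₁ refl
    left (suc t₀) (inj₁ ())
    left (suc t₀) (inj₂ stuck) = inj₂ (subst (λ zs → SCadetᵇ S T zs ≡ false)
      (trans (sym (segment-slice t₀ (suc l))) (cong (segment {k} M t₀) (ℕ.+-suc t₀ l))) stuck)
    right : s + suc l ≡ length M ⊎ SCadetᵇ S T (slice s (suc (suc l)) M) ≡ false →
            suc (s + l) ≡ length M ⊎ SCadetᵇ S T (segment {k} M s (suc (s + l))) ≡ false
    right (inj₁ s+l≡) = inj₁ (trans (sym (ℕ.+-suc s l)) s+l≡)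
    right (inj₂ stuck) = inj₂ (subst (λ zs → SCadetᵇ S T zs ≡ false)
      (trans (sym (segment-slice s (suc l))) (cong (segment {k} M s) (ℕ.+-suc s l))) stuck)

  module _ (C : List (Fin n)) where

    MeetsOther : ℕ → ℕ → Set
    MeetsOther i j = IsMaxSCadetSegment i j × segment {k} M i j ≢ C × Any (_∈ segment {k} M i j) C

    meetsOther? : ∀ i j → Dec (MeetsOther i j)
    meetsOther? i j =
      ((i ℕ.≤? j) ×-dec (j ℕ.<? length M) ×-dec (SCadetᵇ S T (segment {k} M i j) Bool.≟ true) ×-dec
       ((i ℕ.≟ 0) ⊎-dec (SCadetᵇ S T (segment {k} M (pred i) j) Bool.≟ false)) ×-dec
       ((suc j ℕ.≟ length M) ⊎-dec (SCadetᵇ S T (segment {k} M i (suc j)) Bool.≟ false))) ×-dec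
      ¬? (List.≡-dec Fin._≟_ (segment {k} M i j) C) ×-dec
      any? (λ v → v ∈? segment {k} M i j) C
      where open import Data.List.Membership.DecPropositional (Fin._≟_ {n}) using (_∈?_)

    met? : Dec (Σ (Fin (length M)) λ i → Σ (Fin (length M)) λ j → MeetsOther (toℕ i) (toℕ j))
    met? = Fin.any? λ i → Fin.any? λ j → meetsOther? (toℕ i) (toℕ j)

    unmet⇒isolated : ¬ (Σ (Fin (length M)) λ i → Σ (Fin (length M)) λ j → MeetsOther (toℕ i) (toℕ j)) →
                     ∀ s l → MaximalSCadetSlice S T M s l → Any (_∈ slice s l M) C → slice s l M ≡ C
    unmet⇒isolated unmet s zero    _       meets with _ , _ , () ← find meets
    unmet⇒isolated unmet s (suc l) maximal meets with List.≡-dec Fin._≟_ (slice s (suc l) M) C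
    ... | yes slice≡C = slice≡C
    ... | no  slice≢C = ⊥-elim (unmet (fromℕ< s<n , fromℕ< j<n ,
          subst₂ MeetsOther (sym (Fin.toℕ-fromℕ< s<n)) (sym (Fin.toℕ-fromℕ< j<n))
            (segment-max , (λ seg≡C → slice≢C (trans (sym (segment-slice s l)) seg≡C)) ,
             subst (λ zs → Any (_∈ zs) C) (sym (segment-slice s l)) meets)))
      where
      segment-max : IsMaxSCadetSegment s (s + l)
      segment-max = maximal⇒segment s l maximal
      j<n : s + l < length M
      j<n = proj₁ (proj₂ segment-max)
      s<n : s < length M
      s<n = ℕ.≤-<-trans (ℕ.m≤m+n s l) j<n

rS≡0-if-isolated : ∀ {k n} (S : Deformation n) (T : Tree k n) (unique : Unique (labels T))
  (M : List (Fin n)) (maxM : MaxCadetSeq T M) i L → i + L ≤ length M → 1 < L →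
  SCadetᵇ S T (slice i L M) ≡ true →
  (∀ s l → MaximalSCadetSlice S T M s l → Any (_∈ slice s l M) (slice i L M) → slice s l M ≡ slice i L M) →
  rS S T ≡ 0ℤ
rS≡0-if-isolated S T unique M maxM i (suc zero)      _     (s≤s ())
rS≡0-if-isolated S T unique M maxM i (suc (suc L₀)) bound _ = Isolated.rS≡0 S T unique M maxM i L₀ bound

corollary3p19 : (n : ℕ) (S : Deformation n) (T : Tree (suc (mOf S)) n) →
    labels T ↭ allFin n →
    ¬ (rS S T ≡ 0ℤ) →
    (C : List (Fin n)) → MaxSCadetSeq S T C → 1 < length C →
    Σ (List (Fin n)) λ C′ → MaxSCadetSeq S T C′ × ¬ (C′ ≡ C) ×
      Σ (Fin n) λ v → v ∈ C × v ∈ C′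
corollary3p19 n S T labels↭ rS≢0 C (M , maxM , i , j , i≤j , j<M , refl , C-scadet , _ , _) 1<∣C∣
  with met? S T M C
... | yes (i′ , j′ , (i′≤j′ , j′<n , scadet , left , right) , C′≢C , meets)
  with v , v∈C , v∈C′ ← find meets =
  segment {suc (mOf S)} M (toℕ i′) (toℕ j′) ,
  (M , maxM , toℕ i′ , toℕ j′ , i′≤j′ , j′<n , refl , scadet , left , right) , C′≢C , v , v∈C , v∈C′
... | no unmet = ⊥-elim (rS≢0 (rS≡0-if-isolated S T unique M maxM i (suc j ∸ i) bound
                                 (subst (1 <_) (length-slice i (suc j ∸ i) M bound) 1<∣C∣) C-scadet
                                 (unmet⇒isolated S T M C unmet)))
  where
  unique : Unique (labels T)
  unique = ↭ₛ.Unique-resp-↭ (setoid (Fin n)) (↭⇒↭ₛ (↭-sym labels↭)) (allFin⁺ n)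
  bound : i + (suc j ∸ i) ≤ length M
  bound = subst (_≤ length M) (sym (ℕ.m+[n∸m]≡n (ℕ.m≤n⇒m≤1+n i≤j))) j<M
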